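{- Let $S$ be a language with countable symbol set, $X$ a set of formulas of $S$, and $D$ a ruleset of $S$ such that: $R_{\exists\leftarrow}\in D$; $D$ is cut-like; $D$ emulates from $\emptyset$ the ruleset $\{R_0,R_=,R_\leftrightarrow,R_\Rightarrow,R_+,R_{\mathcal R},R_{\exists\rightarrow},R_\downarrow\}$; and $X$ is $D$-consistent. Then there is an interpretation of $S$ with a countable universe satisfying $X$.
   Context: Strings: concatenation is juxtaposition; a symbol is identified with the one-letter string. A language $S$ consists of an integer-valued function $\#$ (arity), an element $\equiv\ \in\operatorname{dom}\#$ with $\#(\equiv)=-2$, and an object $\downarrow\ \notin\operatorname{dom}\#$, with infinitely many literals (symbols $s$ with $\#(s)=0$); the symbol set is $\operatorname{dom}\#\cup\{\downarrow\}$. Terms: smallest set of strings containing each literal $v$ and $s\,t_1\cdots t_n$ whenever $\#(s)=n>0$ and $t_i$ are terms. Formulas: smallest set containing atomic formulas $r\,t_1\cdots t_n$ ($\#(r)=-n<0$), $\downarrow\varphi\psi$ (NOR) and $v\varphi$ ($v$ literal; "there exists $v$"). $\neg\varphi:=\downarrow\varphi\varphi$. $\psi[v_1/v_2]$ replaces every occurrence of literal $v_1$ by literal $v_2$. Term substitution $\psi[v:=t]$: in atomic formulas replace every occurrence of $v$ in the argument terms by $t$; $(\downarrow\varphi\psi)[v:=t]=\downarrow\varphi[v:=t]\psi[v:=t]$; $(v_1\varphi)[v:=t]=v'(\varphi[v_1/v'])[v:=t]$ with $v'$ a literal $\neq v$ not occurring in $t,\varphi$. An interpretation $i$ with nonempty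 universe $U$ assigns to $s$ with $\#(s)\ge0$ a map $U^{\#(s)}\to U$ and to $s$ with $\#(s)<0$ a map $U^{ -\#(s)}\to\{0,1\}$; terms and formulas are evaluated in the usual way ($\equiv t_1t_2$ true iff the values are equal, $\downarrow\varphi\psi$ true iff both false, $v\varphi$ true iff $\varphi$ true under some reassignment of the value of $v$). $i$ satisfies $X$ if all formulas of $X$ evaluate to $1$. A sequent is $(\Gamma,\varphi)$, $\Gamma$ a finite set of formulas, $\varphi$ a formula. A rule maps sets of sequents to sets of sequents; a ruleset is a set of rules. $O_D(\Sigma)=\bigcup_{R\in D}R(\Sigma)$, $O_D^n$ its $n$-th iterate. $X\vdash_D\varphi$ iff some $(\Gamma,\varphi)\in O_D^n(\emptyset)$ with $\Gamma\subseteq X$ finite; $\mathrm{Prov}_D(X)=\{\varphi:X\vdash_D\varphi\}$. $X$ is $D$-consistent if there is no formula $\psi$ with $\psi,\neg\psi\in\mathrm{Prov}_D(X)$, $D$-inconsistent otherwise. $D$ is cut-like if for all $X,\varphi$: $X\cup\{\varphi\}$ $D$-inconsistent implies $X\vdash_D\neg\varphi$. $D_2$ emulates $D_1$ from $\emptyset$ if $\bigcup_{n\ge1}O_{D_1}^n(\emptyset)\subseteq\bigcup_{n\ge1}O_{D_2}^n(\emptyset)$. Rules ($t$'s terms, $\varphi$'s, $\psi$ formulas, $v$'s literals): $R_0(\Sigma)=\{(\{\varphi\},\varphi)\}$; $R_=(\Sigma)=\{(\emptyset,\equiv tt)\}$; $R_\leftrightarrow(\Sigma)=\{(\{\equiv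 t_1t_2\},\equiv t_2t_1)\}$; $R_\Rightarrow(\Sigma)=\{(\{\equiv t_1t_2,\equiv t_2t_3\},\equiv t_1t_3)\}$; $R_+(\Sigma)=\{(\{\equiv t_jt'_j:j\le n\},\equiv st_1\cdots t_n st'_1\cdots t'_n):\#(s)=n>0\}$; $R_{\mathcal R}(\Sigma)=\{(\{\equiv t_jt'_j:j\le n\}\cup\{rt_1\cdots t_n\},rt'_1\cdots t'_n):\#(r)=-n<0\}$; $R_\downarrow(\Sigma)=\{(\{\downarrow\varphi_1\varphi_2,\downarrow\varphi_3\varphi_4\},\downarrow\varphi_2\varphi_3)\}$; $R_{\exists\rightarrow}(\Sigma)=\{(\{\psi[v:=t]\},v\psi)\}$; $R_{\exists\leftarrow}(\Sigma)=\{(\Gamma'\setminus\{\psi[v_1/v_2]\}\cup\{v_1\psi\},\neg{\equiv vv}):(\Gamma'\cup\{\psi[v_1/v_2]\},\neg{\equiv vv})\in\Sigma$, $v_2$ occurring in no element of $\Gamma'\cup\{\psi\}\}$. -}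

module Defs where

open import Data.Nat using (ℕ; zero; suc; _+_)
open import Data.Integer using (ℤ; +_; -[1+_])
open import Data.Integer.Properties using (-[1+-injective)
open import Data.Bool using (Bool; true; false; if_then_else_)
open import Data.Empty using (⊥)
open import Data.Unit using (⊤)
open import Data.Product using (Σ; Σ-syntax; ∃; ∃-syntax; _×_; _,_; proj₁; proj₂)
open import Data.Sum using (_⊎_)
open import Data.Fin using (Fin)
open import Data.List using (List; []; _∷_; _++_; length; [_])
open import Data.List.Membership.Propositional using (_∈_)
open import Data.List.Relation.Unary.Any using (any?)
open import Data.Vec using (Vec; []; _∷_; zipWith; toList)
open import Relation.Binary.PropositionalEquality using (_≡_; _≢_; refl; sym; trans; cong; subst)
open import Relation.Binary.Definitions using (DecidableEquality)
open import Relation.Nullary using (¬_; Dec; yes; no; does)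

Countable : Set → Set
Countable A = Σ[ f ∈ (A → ℕ) ] (∀ {x y} → f x ≡ f y → x ≡ y)

-- A language S.  'Sym' is dom #, 'ar' is #, 'eqs' is ≡.  The NOR symbol ↓
-- is not an element of Sym (it is the constructor 'nor' below).
-- 'lit' witnesses that there are infinitely many literals.

record Language : Set₁ where
  field
    Sym    : Set
    ar     : Sym → ℤ
    _≟S_   : DecidableEquality Sym
    eqs    : Sym
    ar-eqs : ar eqs ≡ -[1+ 1 ]
    lit     : ℕ → Sym
    lit-ar  : ∀ n → ar (lit n) ≡ + 0
    lit-inj : ∀ {m n} → lit m ≡ lit n → m ≡ n

module _ (L : Language) where
  open Language L

  Lit : Set
  Lit = Σ[ v ∈ Sym ] ar v ≡ + 0

  _==_ : Sym → Sym → Bool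
  s == s' = does (s ≟S s')

  -- Terms and formulas (abstract syntax of the prefix strings)

  data Term : Set where
    var : Lit → Term
    app : (s : Sym) {n : ℕ} → ar s ≡ + suc n → Vec Term (suc n) → Term

  data Formula : Set where
    atom : (r : Sym) {n : ℕ} → ar r ≡ -[1+ n ] → Vec Term (suc n) → Formula
    nor  : Formula → Formula → Formula
    ex   : Lit → Formula → Formula

  eqF : Term → Term → Formula
  eqF t₁ t₂ = atom eqs ar-eqs (t₁ ∷ t₂ ∷ [])

  neg : Formula → Formula
  neg φ = nor φ φ

  mutual
    symsT : Term → List Sym
    symsT (var v) = proj₁ v ∷ []
    symsT (app s p ts) = s ∷ symsTs ts

    symsTs : ∀ {n} → Vec Term n → List Sym
    symsTs [] = []
    symsTs (t ∷ ts) = symsT t ++ symsTs ts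

  symsF : Formula → List Sym
  symsF (atom r p ts) = r ∷ symsTs ts
  symsF (nor φ ψ) = symsF φ ++ symsF ψ
  symsF (ex v φ) = proj₁ v ∷ symsF φ

  OccursIn : Lit → Formula → Set
  OccursIn v φ = proj₁ v ∈ symsF φ

  -- literal renaming  ψ[v₁/v₂]  (every occurrence, binders included)

  renL : Lit → Lit → Lit → Lit
  renL v₁ v₂ w = if proj₁ w == proj₁ v₁ then v₂ else w

  mutual
    renT : Lit → Lit → Term → Term
    renT v₁ v₂ (var w) = var (renL v₁ v₂ w)
    renT v₁ v₂ (app s p ts) = app s p (renTs v₁ v₂ ts)

    renTs : ∀ {n} → Lit → Lit → Vec Term n → Vec Term n
    renTs v₁ v₂ [] = []
    renTs v₁ v₂ (t ∷ ts) = renT v₁ v₂ t ∷ renTs v₁ v₂ ts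

  renF : Lit → Lit → Formula → Formula
  renF v₁ v₂ (atom r p ts) = atom r p (renTs v₁ v₂ ts)
  renF v₁ v₂ (nor φ ψ) = nor (renF v₁ v₂ φ) (renF v₁ v₂ ψ)
  renF v₁ v₂ (ex w φ) = ex (renL v₁ v₂ w) (renF v₁ v₂ φ)

  -- choice of a fresh literal: the first lit k not in the avoid list
  -- (exists among lit 0 … lit (length avoid) by injectivity of lit)

  search : List Sym → ℕ → ℕ → ℕ
  search avoid zero k = k
  search avoid (suc f) k with any? (λ s → lit k ≟S s) avoid
  ... | yes _ = search avoid f (suc k)
  ... | no _  = k

  fresh : List Sym → Lit
  fresh avoid = lit (search avoid (length avoid) 0) , lit-ar _

  mutual
    substT : Lit → Term → Term → Term
    substT v t (var w) = if proj₁ w == proj₁ v then t else var w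
    substT v t (app s p ts) = app s p (substTs v t ts)

    substTs : ∀ {n} → Lit → Term → Vec Term n → Vec Term n
    substTs v t [] = []
    substTs v t (u ∷ us) = substT v t u ∷ substTs v t us

  size : Formula → ℕ
  size (atom r p ts) = 1
  size (nor φ ψ) = suc (size φ + size ψ)
  size (ex w φ) = suc (size φ)

  -- fuel-driven; the fuel 'size φ' is always sufficient since renaming
  -- preserves size, so the fallback clause is never reached.
  substFuel : ℕ → Lit → Term → Formula → Formula
  substFuel f v t (atom r p ts) = atom r p (substTs v t ts)
  substFuel zero v t φ = φ
  substFuel (suc f) v t (nor φ ψ) = nor (substFuel f v t φ) (substFuel f v t ψ)
  substFuel (suc f) v t (ex v₁ φ) =
    let v' = fresh (proj₁ v ∷ symsT t ++ symsF φ)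
    in ex v' (substFuel f v t (renF v₁ v' φ))

  substF : Lit → Term → Formula → Formula
  substF v t φ = substFuel (size φ) v t φ

  Den : Set → ℤ → Set
  Den U (+ n) = Vec U n → U
  Den U -[1+ n ] = Vec U (suc n) → Bool

  record Interp : Set₁ where
    field
      U   : Set
      u₀  : U
      fun : (s : Sym) → Den U (ar s)
  open Interp public

  assign : (i : Interp) → Lit → U i → Interp
  assign i v u = record i { fun = f }
    where
    f : (s : Sym) → Den (U i) (ar s)
    f s with s ≟S proj₁ v
    ... | yes e = subst (λ z → Den (U i) (ar z)) (sym e)
                    (subst (Den (U i)) (sym (proj₂ v)) (λ _ → u))
    ... | no _ = fun i s

  mutual
    evalT : (i : Interp) → Term → U i
    evalT i (var v) = subst (Den (U i)) (proj₂ v) (fun i (proj₁ v)) []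
    evalT i (app s p ts) = subst (Den (U i)) p (fun i s) (evalTs i ts)

    evalTs : ∀ {n} (i : Interp) → Vec Term n → Vec (U i) n
    evalTs i [] = []
    evalTs i (t ∷ ts) = evalT i t ∷ evalTs i ts

  eqVal : {A : Set} (n : ℕ) → n ≡ 1 → Vec A (suc n) → Set
  eqVal .1 refl (x ∷ y ∷ []) = x ≡ y

  Sat : Interp → Formula → Set
  Sat i (atom r {n} p ts) with r ≟S eqs
  ... | yes e = eqVal n (-[1+-injective (trans (sym p) (trans (cong ar e) ar-eqs)))
                        (evalTs i ts)
  ... | no _  = subst (Den (U i)) p (fun i r) (evalTs i ts) ≡ true
  Sat i (nor φ ψ) = ¬ Sat i φ × ¬ Sat i ψ
  Sat i (ex v φ) = Σ[ u ∈ U i ] Sat (assign i v u) φ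

  Satisfies : Interp → (Formula → Set) → Set
  Satisfies i X = ∀ φ → X φ → Sat i φ

  -- sequents, rules, rulesets
  -- A finite set Γ is represented by a list; all concrete rules below are
  -- stated up to equality of the underlying sets.

  SeqSet : Set₁
  SeqSet = List Formula → Formula → Set

  Rule : Set₁
  Rule = SeqSet → SeqSet

  SameSet : List Formula → List Formula → Set
  SameSet Γ Δ = (∀ x → x ∈ Γ → x ∈ Δ) × (∀ x → x ∈ Δ → x ∈ Γ)

  record Ruleset : Set₁ where
    field
      Idx   : Set
      rules : Idx → Rule
  open Ruleset public

  RuleIn : Rule → Ruleset → Set₁
  RuleIn R D = Σ[ j ∈ Idx D ] rules D j ≡ R

  O : Ruleset → SeqSet → SeqSet
  O D Σs Γ φ = Σ[ j ∈ Idx D ] rules D j Σs Γ φ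

  iter : Ruleset → ℕ → SeqSet
  iter D zero Γ φ = ⊥
  iter D (suc n) = O D (iter D n)

  Prov : Ruleset → (Formula → Set) → Formula → Set
  Prov D X φ = Σ[ n ∈ ℕ ] Σ[ Γ ∈ List Formula ] iter D n Γ φ × (∀ x → x ∈ Γ → X x)

  Inconsistent : Ruleset → (Formula → Set) → Set
  Inconsistent D X = Σ[ ψ ∈ Formula ] Prov D X ψ × Prov D X (neg ψ)

  Consistent : Ruleset → (Formula → Set) → Set
  Consistent D X = ¬ Inconsistent D X

  CutLike : Ruleset → Set₁
  CutLike D = ∀ (X : Formula → Set) (φ : Formula) →
    Inconsistent D (λ x → X x ⊎ x ≡ φ) → Prov D X (neg φ)

  Emulates : Ruleset → Ruleset → Set
  Emulates D₂ D₁ = ∀ n Γ φ → iter D₁ (suc n) Γ φ → Σ[ m ∈ ℕ ] iter D₂ (suc m) Γ φ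

  R₀ : Rule
  R₀ Σs Γ φ = SameSet Γ [ φ ]

  R₌ : Rule
  R₌ Σs Γ φ = SameSet Γ [] × Σ[ t ∈ Term ] φ ≡ eqF t t

  R↔ : Rule
  R↔ Σs Γ φ = Σ[ t₁ ∈ Term ] Σ[ t₂ ∈ Term ]
    SameSet Γ [ eqF t₁ t₂ ] × φ ≡ eqF t₂ t₁

  R⇒ : Rule
  R⇒ Σs Γ φ = Σ[ t₁ ∈ Term ] Σ[ t₂ ∈ Term ] Σ[ t₃ ∈ Term ]
    SameSet Γ (eqF t₁ t₂ ∷ eqF t₂ t₃ ∷ []) × φ ≡ eqF t₁ t₃

  R₊ : Rule
  R₊ Σs Γ φ = Σ[ s ∈ Sym ] Σ[ n ∈ ℕ ] Σ[ p ∈ ar s ≡ + suc n ]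
    Σ[ ts ∈ Vec Term (suc n) ] Σ[ ts' ∈ Vec Term (suc n) ]
    SameSet Γ (toList (zipWith eqF ts ts')) × φ ≡ eqF (app s p ts) (app s p ts')

  Rᵣ : Rule
  Rᵣ Σs Γ φ = Σ[ r ∈ Sym ] Σ[ n ∈ ℕ ] Σ[ p ∈ ar r ≡ -[1+ n ] ]
    Σ[ ts ∈ Vec Term (suc n) ] Σ[ ts' ∈ Vec Term (suc n) ]
    SameSet Γ (atom r p ts ∷ toList (zipWith eqF ts ts')) × φ ≡ atom r p ts'

  R↓ : Rule
  R↓ Σs Γ φ = Σ[ φ₁ ∈ Formula ] Σ[ φ₂ ∈ Formula ] Σ[ φ₃ ∈ Formula ] Σ[ φ₄ ∈ Formula ]
    SameSet Γ (nor φ₁ φ₂ ∷ nor φ₃ φ₄ ∷ []) × φ ≡ nor φ₂ φ₃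

  R∃→ : Rule
  R∃→ Σs Γ φ = Σ[ ψ ∈ Formula ] Σ[ v ∈ Lit ] Σ[ t ∈ Term ]
    SameSet Γ [ substF v t ψ ] × φ ≡ ex v ψ

  R∃← : Rule
  R∃← Σs Γ φ = Σ[ Γ' ∈ List Formula ] Σ[ ψ ∈ Formula ] Σ[ v₁ ∈ Lit ] Σ[ v₂ ∈ Lit ] Σ[ v ∈ Lit ]
    (Σ[ Γ₀ ∈ List Formula ] Σs Γ₀ (neg (eqF (var v) (var v)))
        × SameSet Γ₀ (renF v₁ v₂ ψ ∷ Γ'))
    × (¬ OccursIn v₂ ψ) × (∀ x → x ∈ Γ' → ¬ OccursIn v₂ x)
    × (∀ x → x ∈ Γ → x ≡ ex v₁ ψ ⊎ (x ∈ Γ' × x ≢ renF v₁ v₂ ψ))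
    × (∀ x → x ≡ ex v₁ ψ ⊎ (x ∈ Γ' × x ≢ renF v₁ v₂ ψ) → x ∈ Γ)
    × φ ≡ neg (eqF (var v) (var v))

  baseRules : Ruleset
  baseRules = record { Idx = Fin 8 ; rules = pick }
    where
    pick : Fin 8 → Rule
    pick Fin.zero = R₀
    pick (Fin.suc Fin.zero) = R₌
    pick (Fin.suc (Fin.suc Fin.zero)) = R↔
    pick (Fin.suc (Fin.suc (Fin.suc Fin.zero))) = R⇒
    pick (Fin.suc (Fin.suc (Fin.suc (Fin.suc Fin.zero)))) = R₊
    pick (Fin.suc (Fin.suc (Fin.suc (Fin.suc (Fin.suc Fin.zero))))) = Rᵣ
    pick (Fin.suc (Fin.suc (Fin.suc (Fin.suc (Fin.suc (Fin.suc Fin.zero)))))) = R∃→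
    pick (Fin.suc (Fin.suc (Fin.suc (Fin.suc (Fin.suc (Fin.suc (Fin.suc Fin.zero))))))) = R↓

-- Henkin's construction works for any consequence relation with the equality and NOR rules,
-- ∃-introduction, cut and ∃-elimination: given a consistent X and an unbounded supply of literals
-- fresh for X, enumerate the formulas through an injective coding and extend X to a maximal
-- consistent set with witnesses; its terms modulo provable equality, each class represented by the
-- term of least code, form a countable model.  X itself may use every literal, so the construction
-- is applied to D only for finite subsets of X, which therefore have models.  Renaming the literals
-- by an injection ρ that leaves infinitely many of them unused makes ρ[X] finitely satisfiable,
-- i.e. consistent for semantic consequence, which is again such a calculus; a countable model of
-- ρ[X] read back along ρ is a model of X.

module Submission where

open import Defs
open import Axiom.DoubleNegationElimination using (em⇒dne)
open import Axiom.ExcludedMiddle using (ExcludedMiddle)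
open import Axiom.UniquenessOfIdentityProofs.WithK using (uip)
open import Data.Bool using (true)
open import Data.Empty using (⊥)
open import Data.Fin using (Fin; toℕ; #_)
open import Data.Fin.Properties using (pigeonhole; toℕ-injective; toℕ≤pred[n])
import Data.Fin.Properties as Finₚ
open import Data.Integer using (ℤ; +_; -[1+_]) renaming (_≟_ to _ℤ≟_)
open import Data.Integer.Properties using (-[1+-injective; +-injective)
open import Data.List using (List; []; _∷_; _++_; length; [_]; filter; lookup)
open import Data.List.Membership.Propositional using (_∈_; _∉_)
open import Data.List.Membership.Propositional.Properties
  using (∈-++⁺ˡ; ∈-++⁺ʳ; ∈-++⁻; ∈-filter⁺; ∈-filter⁻)
open import Data.List.Relation.Unary.Any using (here; there; any?; index)
open import Data.List.Relation.Unary.Any.Properties using (lookup-index)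
open import Data.Nat using (ℕ; zero; suc; _+_; _*_; _≤_; _<_; _⊔_; z≤n; s≤s; s≤s⁻¹)
open import Data.Nat.Properties
  using (suc-injective; *-cancelˡ-≡; even≢odd; +-suc; +-comm; ≤-refl; ≤-trans; ≤-reflexive; ≤-antisym;
         m≤n⇒m<n∨m≡n; ≮⇒≥; m≤m+n; m≤n+m; m≤m⊔n; m≤n⊔m)
open import Data.Nat.Induction using (<-rec)
open import Data.Product using (Σ; Σ-syntax; ∃-syntax; _×_; _,_; proj₁; proj₂)
open import Data.Product.Function.NonDependent.Propositional using (_×-⇔_)
open import Data.Sum using (_⊎_; inj₁; inj₂; [_,_]′; map₂)
open import Data.Vec using (Vec; []; _∷_; zipWith) renaming (toList to vtoList; map to vmap)
open import Function.Bundles using (_⇔_; mk⇔; Equivalence)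
open import Function.Base using (case_of_; _$_; _∘_)
open import Function.Construct.Composition using () renaming (equivalence to ⇔-trans)
open import Function.Construct.Symmetry using (⇔-sym)
open import Function.Definitions using (Injective)
open import Function.Related.TypeIsomorphisms using (¬-cong-⇔)
open import Level using (Level)
open import Relation.Binary.PropositionalEquality
  using (_≡_; _≢_; refl; sym; trans; cong; cong₂; subst; module ≡-Reasoning)
open import Relation.Nullary using (¬_; Dec; yes; no; does; contradiction)
open import Relation.Nullary.Decidable using (¬?; dec-true; dec-false)

open Equivalence using (to; from)

opaque
  pair : ℕ → ℕ → ℕ
  pair zero    b = suc (2 * b)
  pair (suc a) b = 2 * pair a b

  pair-injective : ∀ a b c d → pair a b ≡ pair c d → a ≡ c × b ≡ d
  pair-injective zero    b zero    d e = refl , *-cancelˡ-≡ b d 2 (suc-injective e)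
  pair-injective zero    b (suc c) d e = contradiction (sym e) (even≢odd (pair c d) b)
  pair-injective (suc a) b zero    d e = contradiction e (even≢odd (pair a b) d)
  pair-injective (suc a) b (suc c) d e with pair-injective a b c d (*-cancelˡ-≡ _ _ 2 e)
  ... | refl , refl = refl , refl

pigeonhole-∈ : ∀ {A : Set} {f : ℕ → A} → Injective _≡_ _≡_ f →
               (xs : List A) → ¬ (∀ j → j ≤ length xs → f j ∈ xs)
pigeonhole-∈ {f = f} f-inj xs covered =
  let i , j , i<j , same = pigeonhole ≤-refl (λ j → index (member j))
  in Finₚ.<-irrefl (toℕ-injective (f-inj (trans (lookup-index (member i))
                    (trans (cong (lookup xs) same) (sym (lookup-index (member j))))))) i<j
  where
  member : (j : Fin (suc (length xs))) → f (toℕ j) ∈ xs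
  member j = covered (toℕ j) (toℕ≤pred[n] j)

module Classical (lem : ∀ {ℓ} → ExcludedMiddle ℓ) where

  injective-avoids : ∀ {A : Set} {f : ℕ → A} → Injective _≡_ _≡_ f → (xs : List A) → ∃[ k ] f k ∉ xs
  injective-avoids f-inj xs =
    em⇒dne lem λ none → pigeonhole-∈ f-inj xs (λ j _ → em⇒dne lem λ fj∉ → none (j , fj∉))

  least : (Q : ℕ → Set) {n : ℕ} → Q n → Σ[ m ∈ ℕ ] Q m × (∀ j → Q j → m ≤ j)
  least Q {n} = <-rec (λ n → Q n → Σ[ m ∈ ℕ ] Q m × (∀ j → Q j → m ≤ j)) below n
    where
    below : ∀ n → (∀ {j} → j < n → Q j → Σ[ m ∈ ℕ ] Q m × (∀ j → Q j → m ≤ j)) →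
            Q n → Σ[ m ∈ ℕ ] Q m × (∀ j → Q j → m ≤ j)
    below n rec qn with lem {P = Σ[ j ∈ ℕ ] j < n × Q j}
    ... | yes (j , j<n , qj) = rec j<n qj
    ... | no none            = n , qn , λ j qj → ≮⇒≥ λ j<n → none (j , j<n , qj)

<-extend : ∀ {P : ℕ → Set} {k} → (∀ j → j < k → P j) → P k → ∀ j → j ≤ k → P j
<-extend below Pk j j≤k with m≤n⇒m<n∨m≡n j≤k
... | inj₁ j<k  = below j j<k
... | inj₂ refl = Pk

¬×¬-cong-⇔ : ∀ {A A′ B B′ : Set} → A ⇔ A′ → B ⇔ B′ → (¬ A × ¬ B) ⇔ (¬ A′ × ¬ B′)
¬×¬-cong-⇔ A⇔A′ B⇔B′ = ¬-cong-⇔ A⇔A′ ×-⇔ ¬-cong-⇔ B⇔B′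

does-true⇒ : ∀ {A : Set} (a? : Dec A) → does a? ≡ true → A
does-true⇒ (yes a) _ = a

∃-cong-⇔ : ∀ {U : Set} {A B : U → Set} → (∀ u → A u ⇔ B u) → Σ U A ⇔ Σ U B
∃-cong-⇔ A⇔B = mk⇔ (λ (u , a) → u , to (A⇔B u) a) (λ (u , b) → u , from (A⇔B u) b)

module Syntax (L : Language) where
  open Language L

  Lit-≡ : (v w : Lit L) → proj₁ v ≡ proj₁ w → v ≡ w
  Lit-≡ (s , p) (.s , q) refl = cong (s ,_) (uip p q)

  positive-arity≢0 : ∀ {s n} → ar s ≡ + suc n → ar s ≢ + 0
  positive-arity≢0 p q with () ← trans (sym p) q

  negative-arity≢0 : ∀ {s n} → ar s ≡ -[1+ n ] → ar s ≢ + 0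
  negative-arity≢0 p q with () ← trans (sym p) q

  nonliteral≢literal : ∀ {s} → ar s ≢ + 0 → (v : Lit L) → s ≢ proj₁ v
  nonliteral≢literal ar≢0 (_ , v-ar) refl = ar≢0 v-ar

  function≢literal : ∀ {s n} (v : Lit L) → ar s ≡ + suc n → s ≢ proj₁ v
  function≢literal v p = nonliteral≢literal (positive-arity≢0 p) v

  relation≢literal : ∀ {s n} (v : Lit L) → ar s ≡ -[1+ n ] → s ≢ proj₁ v
  relation≢literal v p = nonliteral≢literal (negative-arity≢0 p) v

  renL-hit : ∀ v₁ v₂ w → proj₁ w ≡ proj₁ v₁ → renL L v₁ v₂ w ≡ v₂
  renL-hit v₁ v₂ w e rewrite dec-true (proj₁ w ≟S proj₁ v₁) e = refl

  renL-miss : ∀ v₁ v₂ w → proj₁ w ≢ proj₁ v₁ → renL L v₁ v₂ w ≡ w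
  renL-miss v₁ v₂ w ne rewrite dec-false (proj₁ w ≟S proj₁ v₁) ne = refl

  search-∉ : ∀ avoid f k → (∀ j → j < k → lit j ∈ avoid) → f + k ≡ length avoid →
             lit (search L avoid f k) ∉ avoid
  search-∉ avoid zero k below refl lit-k∈ = pigeonhole-∈ lit-inj avoid (<-extend below lit-k∈)
  search-∉ avoid (suc f) k below e with any? (λ s → lit k ≟S s) avoid
  ... | no lit-k∉  = lit-k∉
  ... | yes lit-k∈ = search-∉ avoid f (suc k) (λ j j<1+k → <-extend below lit-k∈ j (s≤s⁻¹ j<1+k))
                              (trans (+-suc f k) e)

  fresh-∉ : ∀ avoid → proj₁ (fresh L avoid) ∉ avoid
  fresh-∉ avoid = search-∉ avoid (length avoid) 0 (λ _ ()) (+-comm (length avoid) 0)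

  substT-hit : ∀ v t w → proj₁ w ≡ proj₁ v → substT L v t (var w) ≡ t
  substT-hit v t w e rewrite dec-true (proj₁ w ≟S proj₁ v) e = refl

  substT-miss : ∀ v t w → proj₁ w ≢ proj₁ v → substT L v t (var w) ≡ var w
  substT-miss v t w ne rewrite dec-false (proj₁ w ≟S proj₁ v) ne = refl

  size-renF : ∀ v₁ v₂ φ → size L (renF L v₁ v₂ φ) ≡ size L φ
  size-renF v₁ v₂ (atom r p ts) = refl
  size-renF v₁ v₂ (nor φ ψ) = cong₂ (λ a b → suc (a + b)) (size-renF v₁ v₂ φ) (size-renF v₁ v₂ ψ)
  size-renF v₁ v₂ (ex w φ) = cong suc (size-renF v₁ v₂ φ)

  size-substFuel : ∀ f v t φ → size L φ ≤ f → size L (substFuel L f v t φ) ≡ size L φ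
  size-substFuel f v t (atom r p ts) _ = refl
  size-substFuel (suc f) v t (nor φ ψ) (s≤s le) =
    cong₂ (λ a b → suc (a + b)) (size-substFuel f v t φ (≤-trans (m≤m+n _ _) le))
                                (size-substFuel f v t ψ (≤-trans (m≤n+m _ _) le))
  size-substFuel (suc f) v t (ex w φ) (s≤s le) =
    cong suc (trans (size-substFuel f v t (renF L w _ φ) (≤-trans (≤-reflexive (size-renF w _ φ)) le))
                    (size-renF w _ φ))

  size-substF : ∀ v t φ → size L (substF L v t φ) ≡ size L φ
  size-substF v t φ = size-substFuel (size L φ) v t φ ≤-refl

module Semantics (L : Language) where
  open Language L
  open Syntax L

  -- Without function extensionality, interpretations of a symbol are compared pointwise.
  DenEq : ∀ {A : Set} (z : ℤ) → Den L A z → Den L A z → Set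
  DenEq (+ n)    f g = ∀ xs → f xs ≡ g xs
  DenEq -[1+ n ] f g = ∀ xs → f xs ≡ g xs

  DenEq-refl : ∀ {A : Set} z (f : Den L A z) → DenEq z f f
  DenEq-refl (+ n)    f xs = refl
  DenEq-refl -[1+ n ] f xs = refl

  DenEq-sym : ∀ {A : Set} z {f g : Den L A z} → DenEq z f g → DenEq z g f
  DenEq-sym (+ n)    f≗g xs = sym (f≗g xs)
  DenEq-sym -[1+ n ] f≗g xs = sym (f≗g xs)

  DenEq-trans : ∀ {A : Set} z {f g h : Den L A z} → DenEq z f g → DenEq z g h → DenEq z f h
  DenEq-trans (+ n)    f≗g g≗h xs = trans (f≗g xs) (g≗h xs)
  DenEq-trans -[1+ n ] f≗g g≗h xs = trans (f≗g xs) (g≗h xs)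

  DenEq-subst : ∀ {A : Set} {z z′} (p : z ≡ z′) {f g : Den L A z} → DenEq z f g →
                DenEq z′ (subst (Den L A) p f) (subst (Den L A) p g)
  DenEq-subst refl f≗g = f≗g

  DenEq-≡ : ∀ {A : Set} z {f g : Den L A z} → f ≡ g → DenEq z f g
  DenEq-≡ z {f} refl = DenEq-refl z f

  DenEq-constant : ∀ {A : Set} {z} (e : z ≡ + 0) (f g : Den L A z) →
                   subst (Den L A) e f [] ≡ subst (Den L A) e g [] → DenEq z f g
  DenEq-constant refl f g f≡g [] = f≡g

  subst-cancel : ∀ {A : Set} {z} (e : z ≡ + 0) (F : Den L A (+ 0)) →
                 subst (Den L A) e (subst (Den L A) (sym e) F) ≡ F
  subst-cancel refl F = refl

  _⟨_⟩ : (i : Interp L) → ((s : Sym) → Den L (U i) (ar s)) → Interp L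
  i ⟨ g ⟩ = record i { fun = g }

  record Agree (i : Interp L) (g : (s : Sym) → Den L (U i) (ar s)) (P : Sym → Set) : Set where
    constructor agreeing
    field agree : ∀ s → P s → DenEq (ar s) (fun i s) (g s)
  open Agree

  Agree-mono : ∀ {i g} {P Q : Sym → Set} → (∀ s → Q s → P s) → Agree i g P → Agree i g Q
  Agree-mono Q⊆P i≈g = agreeing λ s q → agree i≈g s (Q⊆P s q)

  Agree-sym : ∀ {i g P} → Agree i g P → Agree (i ⟨ g ⟩) (fun i) P
  Agree-sym i≈g = agreeing λ s p → DenEq-sym (ar s) (agree i≈g s p)

  Agree-trans : ∀ {i g h P} → Agree i g P → Agree (i ⟨ g ⟩) h P → Agree i h P
  Agree-trans i≈g g≈h = agreeing λ s p → DenEq-trans (ar s) (agree i≈g s p) (agree g≈h s p)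

  litVal : (i : Interp L) → Lit L → U i
  litVal i w = evalT L i (var w)

  assign-other : ∀ (i : Interp L) v u s → s ≢ proj₁ v → fun (assign L i v u) s ≡ fun i s
  assign-other i v u s s≢v with s ≟S proj₁ v
  ... | yes s≡v = contradiction s≡v s≢v
  ... | no _    = refl

  litVal-assign-same : ∀ (i : Interp L) v u w → proj₁ w ≡ proj₁ v → litVal (assign L i v u) w ≡ u
  litVal-assign-same i (s , p) u (.s , q) refl with s ≟S s
  ... | no s≢s = contradiction refl s≢s
  ... | yes refl rewrite uip p q = cong (λ F → F []) (subst-cancel q (λ _ → u))

  litVal-assign-other : ∀ (i : Interp L) v u w → proj₁ w ≢ proj₁ v →
                        litVal (assign L i v u) w ≡ litVal i w
  litVal-assign-other i v u w w≢v rewrite assign-other i v u (proj₁ w) w≢v = refl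

  assign-fresh : ∀ {i v u} → Agree (assign L i v u) (fun i) (λ s → s ≢ proj₁ v)
  assign-fresh {i} {v} {u} = agreeing λ s s≢v → DenEq-≡ (ar s) (assign-other i v u s s≢v)

  assign-fresh-for : ∀ {i v u} {xs : List Sym} → proj₁ v ∉ xs → Agree (assign L i v u) (fun i) (_∈ xs)
  assign-fresh-for v∉ = Agree-mono (λ { _ s∈ refl → v∉ s∈ }) assign-fresh

  assign-agree : ∀ {i g v a b P} → a ≡ b → Agree i g (λ s → P s × s ≢ proj₁ v) →
                 Agree (assign L i v a) (fun (assign L (i ⟨ g ⟩) v b)) P
  assign-agree {i} {g} {v} {a} {P = P} refl i≈g = agreeing pointwise
    where
    pointwise : ∀ s → P s → DenEq (ar s) (fun (assign L i v a) s) (fun (assign L (i ⟨ g ⟩) v a) s)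
    pointwise s p with s ≟S proj₁ v
    ... | yes _   = DenEq-refl (ar s) _
    ... | no s≢v  = agree i≈g s (p , s≢v)

  literal-agree : ∀ (i : Interp L) g (w : Lit L) → litVal i w ≡ litVal (i ⟨ g ⟩) w →
                  DenEq (ar (proj₁ w)) (fun i (proj₁ w)) (g (proj₁ w))
  literal-agree i g w = DenEq-constant (proj₂ w) _ _

  assign-comm : ∀ {i v w a a′ b P} → a ≡ a′ → proj₁ v ≢ proj₁ w →
                Agree (assign L (assign L i w b) v a) (fun (assign L (assign L i v a′) w b)) P
  assign-comm {i} {v} {w} {a} {_} {b} refl v≢w = agreeing λ s _ → case s ≟S proj₁ v of λ where
      (yes refl) → literal-agree I J v (trans (litVal-assign-same (assign L i w b) v a v refl)
                     (sym (trans (litVal-assign-other (assign L i v a) w b v v≢w) (litVal-assign-same i v a v refl))))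
      (no s≢v) → case s ≟S proj₁ w of λ where
        (yes refl) → literal-agree I J w (trans (litVal-assign-other (assign L i w b) v a w s≢v)
                       (trans (litVal-assign-same i w b w refl) (sym (litVal-assign-same (assign L i v a) w b w refl))))
        (no s≢w) → DenEq-≡ (ar s) (trans (assign-other _ v a s s≢v) (trans (assign-other i w b s s≢w)
                     (sym (trans (assign-other _ w b s s≢w) (assign-other i v a s s≢v)))))
    where
    I : Interp L
    I = assign L (assign L i w b) v a
    J : (s : Sym) → Den L (U i) (ar s)
    J = fun (assign L (assign L i v a) w b)

  mutual
    evalT-agree : ∀ t (i : Interp L) g → Agree i g (_∈ symsT L t) → evalT L i t ≡ evalT L (i ⟨ g ⟩) t
    evalT-agree (var w) i g i≈g = DenEq-subst (proj₂ w) (agree i≈g (proj₁ w) (here refl)) []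
    evalT-agree (app s p ts) i g i≈g =
      trans (cong (subst (Den L (U i)) p (fun i s)) (evalTs-agree ts i g (Agree-mono (λ _ → there) i≈g)))
            (DenEq-subst p (agree i≈g s (here refl)) _)

    evalTs-agree : ∀ {n} (ts : Vec (Term L) n) (i : Interp L) g → Agree i g (_∈ symsTs L ts) →
                   evalTs L i ts ≡ evalTs L (i ⟨ g ⟩) ts
    evalTs-agree []       i g i≈g = refl
    evalTs-agree (t ∷ ts) i g i≈g =
      cong₂ _∷_ (evalT-agree t i g (Agree-mono (λ _ → ∈-++⁺ˡ) i≈g))
                (evalTs-agree ts i g (Agree-mono (λ _ → ∈-++⁺ʳ (symsT L t)) i≈g))

  Sat-atom-cong : ∀ (i : Interp L) g r {n} (p : ar r ≡ -[1+ n ]) ts ts′ → DenEq (ar r) (fun i r) (g r) →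
                  evalTs L i ts ≡ evalTs L (i ⟨ g ⟩) ts′ →
                  Sat L i (atom r p ts) → Sat L (i ⟨ g ⟩) (atom r p ts′)
  Sat-atom-cong i g r p ts ts′ r≗ ts≡ sat with r ≟S eqs
  ... | yes _ = subst (eqVal L _ _) ts≡ sat
  ... | no _  = trans (sym (trans (cong (subst (Den L (U i)) p (fun i r)) ts≡) (DenEq-subst p r≗ _))) sat

  Sat-atom-cong-⇔ : ∀ (i : Interp L) g r {n} (p : ar r ≡ -[1+ n ]) ts ts′ → DenEq (ar r) (fun i r) (g r) →
                    evalTs L i ts ≡ evalTs L (i ⟨ g ⟩) ts′ →
                    Sat L i (atom r p ts) ⇔ Sat L (i ⟨ g ⟩) (atom r p ts′)
  Sat-atom-cong-⇔ i g r p ts ts′ r≗ ts≡ =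
    mk⇔ (Sat-atom-cong i g r p ts ts′ r≗ ts≡)
        (Sat-atom-cong (i ⟨ g ⟩) (fun i) r p ts′ ts (DenEq-sym (ar r) r≗) (sym ts≡))

  Sat-agree : ∀ φ (i : Interp L) g → Agree i g (_∈ symsF L φ) → Sat L i φ → Sat L (i ⟨ g ⟩) φ
  Sat-agree (atom r p ts) i g i≈g =
    Sat-atom-cong i g r p ts ts (agree i≈g r (here refl)) (evalTs-agree ts i g (Agree-mono (λ _ → there) i≈g))
  Sat-agree (nor φ ψ) i g i≈g (¬φ , ¬ψ) =
    (λ φ-sat → ¬φ (Sat-agree φ (i ⟨ g ⟩) (fun i) (Agree-sym (Agree-mono (λ _ → ∈-++⁺ˡ) i≈g)) φ-sat)) ,
    (λ ψ-sat → ¬ψ (Sat-agree ψ (i ⟨ g ⟩) (fun i)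
                     (Agree-sym (Agree-mono (λ _ → ∈-++⁺ʳ (symsF L φ)) i≈g)) ψ-sat))
  Sat-agree (ex v φ) i g i≈g (u , sat) =
    u , Sat-agree φ (assign L i v u) _ (assign-agree refl (Agree-mono (λ _ (h , _) → there h) i≈g)) sat

  Sat-agree-⇔ : ∀ φ (i : Interp L) g → Agree i g (_∈ symsF L φ) → Sat L i φ ⇔ Sat L (i ⟨ g ⟩) φ
  Sat-agree-⇔ φ i g i≈g = mk⇔ (Sat-agree φ i g i≈g) (Sat-agree φ (i ⟨ g ⟩) (fun i) (Agree-sym i≈g))

  mutual
    evalT-renT : ∀ t (j : Interp L) v₁ v₂ →
                 evalT L j (renT L v₁ v₂ t) ≡ evalT L (assign L j v₁ (litVal j v₂)) t
    evalT-renT (var w) j v₁ v₂ = case proj₁ w ≟S proj₁ v₁ of λ where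
      (yes w≡v₁) → trans (cong (litVal j) (renL-hit v₁ v₂ w w≡v₁)) (sym (litVal-assign-same j v₁ _ w w≡v₁))
      (no w≢v₁)  → trans (cong (litVal j) (renL-miss v₁ v₂ w w≢v₁))
                         (sym (litVal-assign-other j v₁ _ w w≢v₁))
    evalT-renT (app s p ts) j v₁ v₂ =
      trans (cong (subst (Den L (U j)) p (fun j s)) (evalTs-renTs ts j v₁ v₂))
            (cong (λ F → subst (Den L (U j)) p F _) (sym (assign-other j v₁ _ s (function≢literal v₁ p))))

    evalTs-renTs : ∀ {n} (ts : Vec (Term L) n) (j : Interp L) v₁ v₂ →
                   evalTs L j (renTs L v₁ v₂ ts) ≡ evalTs L (assign L j v₁ (litVal j v₂)) ts
    evalTs-renTs []       j v₁ v₂ = refl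
    evalTs-renTs (t ∷ ts) j v₁ v₂ = cong₂ _∷_ (evalT-renT t j v₁ v₂) (evalTs-renTs ts j v₁ v₂)

  Sat-renF : ∀ φ (j : Interp L) v₁ v₂ → proj₁ v₂ ∉ symsF L φ →
             Sat L j (renF L v₁ v₂ φ) ⇔ Sat L (assign L j v₁ (litVal j v₂)) φ
  Sat-renF (atom r p ts) j v₁ v₂ _ =
    Sat-atom-cong-⇔ j _ r p (renTs L v₁ v₂ ts) ts
      (DenEq-≡ (ar r) (sym (assign-other j v₁ _ r (relation≢literal v₁ p)))) (evalTs-renTs ts j v₁ v₂)
  Sat-renF (nor φ ψ) j v₁ v₂ v₂∉ =
    ¬×¬-cong-⇔ (Sat-renF φ j v₁ v₂ (v₂∉ ∘ ∈-++⁺ˡ)) (Sat-renF ψ j v₁ v₂ (v₂∉ ∘ ∈-++⁺ʳ (symsF L φ)))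
  Sat-renF (ex w φ) j v₁ v₂ v₂∉ with proj₁ w ≟S proj₁ v₁
  ... | yes w≡v₁ rewrite Lit-≡ w v₁ w≡v₁ = ∃-cong-⇔ λ u →
    ⇔-trans (Sat-renF φ (assign L j v₂ u) v₁ v₂ v₂∉φ) $
    Sat-agree-⇔ φ _ _ (assign-agree (litVal-assign-same j v₂ u v₂ refl)
      (Agree-trans (Agree-mono (λ _ → proj₁) (assign-fresh-for v₂∉φ))
                   (Agree-sym (Agree-mono (λ _ → proj₂) assign-fresh))))
    where
    v₂∉φ : proj₁ v₂ ∉ symsF L φ
    v₂∉φ h = v₂∉ (there h)
  ... | no w≢v₁ = ∃-cong-⇔ λ u →
    ⇔-trans (Sat-renF φ (assign L j w u) v₁ v₂ (λ h → v₂∉ (there h))) $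
    Sat-agree-⇔ φ _ _ (assign-comm (litVal-assign-other j w u v₂ (λ v₂≡w → v₂∉ (here v₂≡w)))
                                   (λ v₁≡w → w≢v₁ (sym v₁≡w)))

  mutual
    evalT-substT : ∀ u (i : Interp L) v t →
                   evalT L i (substT L v t u) ≡ evalT L (assign L i v (evalT L i t)) u
    evalT-substT (var w) i v t = case proj₁ w ≟S proj₁ v of λ where
      (yes w≡v) → trans (cong (evalT L i) (substT-hit v t w w≡v)) (sym (litVal-assign-same i v _ w w≡v))
      (no w≢v)  → trans (cong (evalT L i) (substT-miss v t w w≢v)) (sym (litVal-assign-other i v _ w w≢v))
    evalT-substT (app s p ts) i v t =
      trans (cong (subst (Den L (U i)) p (fun i s)) (evalTs-substTs ts i v t))
            (cong (λ F → subst (Den L (U i)) p F _) (sym (assign-other i v _ s (function≢literal v p))))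

    evalTs-substTs : ∀ {n} (ts : Vec (Term L) n) (i : Interp L) v t →
                     evalTs L i (substTs L v t ts) ≡ evalTs L (assign L i v (evalT L i t)) ts
    evalTs-substTs []       i v t = refl
    evalTs-substTs (u ∷ us) i v t = cong₂ _∷_ (evalT-substT u i v t) (evalTs-substTs us i v t)

  Sat-substFuel : ∀ f φ (i : Interp L) v t → size L φ ≤ f →
                  Sat L i (substFuel L f v t φ) ⇔ Sat L (assign L i v (evalT L i t)) φ
  Sat-substFuel f (atom r p ts) i v t _ =
    Sat-atom-cong-⇔ i _ r p (substTs L v t ts) ts
      (DenEq-≡ (ar r) (sym (assign-other i v _ r (relation≢literal v p)))) (evalTs-substTs ts i v t)
  Sat-substFuel (suc f) (nor φ ψ) i v t (s≤s le) =
    ¬×¬-cong-⇔ (Sat-substFuel f φ i v t (≤-trans (m≤m+n _ _) le))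
               (Sat-substFuel f ψ i v t (≤-trans (m≤n+m _ _) le))
  Sat-substFuel (suc f) (ex v₁ φ) i v t (s≤s le) = ∃-cong-⇔ λ u →
    ⇔-trans (Sat-substFuel f (renF L v₁ v′ φ) (assign L i v′ u) v t
               (≤-trans (≤-reflexive (size-renF v₁ v′ φ)) le)) $
    ⇔-trans (Sat-renF φ _ v₁ v′ v′∉φ) $
    Sat-agree-⇔ φ _ _
      (assign-agree (trans (litVal-assign-other _ v _ v′ (v′∉ ∘ here)) (litVal-assign-same i v′ u v′ refl))
      (assign-agree (evalT-agree t (assign L i v′ u) (fun i) (assign-fresh-for (v′∉ ∘ there ∘ ∈-++⁺ˡ)))
      (Agree-mono (λ _ → proj₁ ∘ proj₁) (assign-fresh-for v′∉φ))))
    where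
    v′ : Lit L
    v′ = fresh L (proj₁ v ∷ symsT L t ++ symsF L φ)
    v′∉ : proj₁ v′ ∉ proj₁ v ∷ symsT L t ++ symsF L φ
    v′∉ = fresh-∉ _
    v′∉φ : proj₁ v′ ∉ symsF L φ
    v′∉φ h = v′∉ (there (∈-++⁺ʳ (symsT L t) h))

  Sat-substF : ∀ φ (i : Interp L) v t → Sat L i (substF L v t φ) ⇔ Sat L (assign L i v (evalT L i t)) φ
  Sat-substF φ i v t = Sat-substFuel (size L φ) φ i v t ≤-refl

  Sat-eqF : ∀ (i : Interp L) a b → Sat L i (eqF L a b) ⇔ (evalT L i a ≡ evalT L i b)
  Sat-eqF i a b with eqs ≟S eqs
  ... | yes e      = eqVal-two (-[1+-injective (trans (sym ar-eqs) (trans (cong ar e) ar-eqs)))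
    where
    eqVal-two : (q : 1 ≡ 1) → eqVal L 1 q (evalT L i a ∷ evalT L i b ∷ []) ⇔ (evalT L i a ≡ evalT L i b)
    eqVal-two refl = mk⇔ (λ e → e) (λ e → e)
  ... | no eqs≢eqs = contradiction refl eqs≢eqs

  atom-eqs : ∀ {r n} (p : ar r ≡ -[1+ n ]) (ts : Vec (Term L) (suc n)) → r ≡ eqs →
             Σ[ a ∈ Term L ] Σ[ b ∈ Term L ] atom r p ts ≡ eqF L a b
  atom-eqs p ts refl with -[1+-injective (trans (sym p) ar-eqs)
  atom-eqs p (a ∷ b ∷ []) refl | refl rewrite uip p ar-eqs = a , b , refl

  Sat-atom-≢eqs : ∀ (i : Interp L) {r n} (p : ar r ≡ -[1+ n ]) ts → r ≢ eqs →
                  Sat L i (atom r p ts) ≡ (subst (Den L (U i)) p (fun i r) (evalTs L i ts) ≡ true)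
  Sat-atom-≢eqs i {r} p ts r≢eqs with r ≟S eqs
  ... | yes r≡eqs = contradiction r≡eqs r≢eqs
  ... | no _      = refl

module Coding (L : Language) (countable : Countable (Language.Sym L)) where
  open Language L
  open Syntax L

  private
    code : Sym → ℕ
    code = proj₁ countable

    code-injective : ∀ {s s′} → code s ≡ code s′ → s ≡ s′
    code-injective = proj₂ countable

  mutual
    codeT : Term L → ℕ
    codeT (var w)      = pair 0 (code (proj₁ w))
    codeT (app s p ts) = pair 1 (pair (code s) (codeTs ts))

    codeTs : ∀ {n} → Vec (Term L) n → ℕ
    codeTs []       = 0
    codeTs (t ∷ ts) = suc (pair (codeT t) (codeTs ts))

  codeF : Formula L → ℕ
  codeF (atom r p ts) = pair 0 (pair (code r) (codeTs ts))
  codeF (nor φ ψ)     = pair 1 (pair (codeF φ) (codeF ψ))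
  codeF (ex w φ)      = pair 2 (pair (code (proj₁ w)) (codeF φ))

  private
    tag≢ : ∀ m n {a b} → m ≢ n → pair m a ≢ pair n b
    tag≢ m n m≢n e = m≢n (proj₁ (pair-injective m _ n _ e))

    payload : ∀ n {a b} → pair n a ≡ pair n b → a ≡ b
    payload n e = proj₂ (pair-injective n _ n _ e)

  mutual
    codeT-injective : ∀ t t′ → codeT t ≡ codeT t′ → t ≡ t′
    codeT-injective (var w) (var w′) e = cong var (Lit-≡ w w′ (code-injective (payload 0 e)))
    codeT-injective (var w) (app s p ts) e = contradiction e (tag≢ 0 1 λ ())
    codeT-injective (app s p ts) (var w) e = contradiction e (tag≢ 1 0 λ ())
    codeT-injective (app s p ts) (app s′ p′ ts′) e =
      let s≡s′ , ts≡ts′ = pair-injective _ _ _ _ (payload 1 e)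
      in app-≡ p p′ ts ts′ (code-injective s≡s′) ts≡ts′

    app-≡ : ∀ {s s′ n n′} (p : ar s ≡ + suc n) (p′ : ar s′ ≡ + suc n′) ts ts′ → s ≡ s′ →
            codeTs ts ≡ codeTs ts′ → app s p ts ≡ app s′ p′ ts′
    app-≡ p p′ ts ts′ refl e with suc-injective (+-injective (trans (sym p) p′))
    ... | refl rewrite uip p p′ = cong (app _ p′) (codeTs-injective ts ts′ e)

    codeTs-injective : ∀ {n} (ts ts′ : Vec (Term L) n) → codeTs ts ≡ codeTs ts′ → ts ≡ ts′
    codeTs-injective []       []         e = refl
    codeTs-injective (t ∷ ts) (t′ ∷ ts′) e =
      let t≡t′ , ts≡ts′ = pair-injective _ _ _ _ (suc-injective e)
      in cong₂ _∷_ (codeT-injective t t′ t≡t′) (codeTs-injective ts ts′ ts≡ts′)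

  atom-≡ : ∀ {r r′ n n′} (p : ar r ≡ -[1+ n ]) (p′ : ar r′ ≡ -[1+ n′ ]) ts ts′ → r ≡ r′ →
           codeTs ts ≡ codeTs ts′ → atom r p ts ≡ atom r′ p′ ts′
  atom-≡ p p′ ts ts′ refl e with -[1+-injective (trans (sym p) p′)
  ... | refl rewrite uip p p′ = cong (atom _ p′) (codeTs-injective ts ts′ e)

  codeF-injective : ∀ φ ψ → codeF φ ≡ codeF ψ → φ ≡ ψ
  codeF-injective (atom r p ts) (atom r′ p′ ts′) e =
    let r≡r′ , ts≡ts′ = pair-injective _ _ _ _ (payload 0 e)
    in atom-≡ p p′ ts ts′ (code-injective r≡r′) ts≡ts′
  codeF-injective (nor φ ψ) (nor φ′ ψ′) e =
    let φ≡φ′ , ψ≡ψ′ = pair-injective _ _ _ _ (payload 1 e)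
    in cong₂ nor (codeF-injective φ φ′ φ≡φ′) (codeF-injective ψ ψ′ ψ≡ψ′)
  codeF-injective (ex w φ) (ex w′ φ′) e =
    let w≡w′ , φ≡φ′ = pair-injective _ _ _ _ (payload 2 e)
    in cong₂ ex (Lit-≡ w w′ (code-injective w≡w′)) (codeF-injective φ φ′ φ≡φ′)
  codeF-injective (atom _ _ _) (nor _ _)    e = contradiction e (tag≢ 0 1 λ ())
  codeF-injective (atom _ _ _) (ex _ _)     e = contradiction e (tag≢ 0 2 λ ())
  codeF-injective (nor _ _)    (atom _ _ _) e = contradiction e (tag≢ 1 0 λ ())
  codeF-injective (nor _ _)    (ex _ _)     e = contradiction e (tag≢ 1 2 λ ())
  codeF-injective (ex _ _)     (atom _ _ _) e = contradiction e (tag≢ 2 0 λ ())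
  codeF-injective (ex _ _)     (nor _ _)    e = contradiction e (tag≢ 2 1 λ ())

-- Henkin's construction for an abstract consequence relation

module Henkin (lem : ∀ {ℓ} → ExcludedMiddle ℓ) (L : Language) (countable : Countable (Language.Sym L)) where
  open Language L
  open Syntax L
  open Semantics L
  open Coding L countable
  open Classical lem

  Theory : Set₁
  Theory = Formula L → Set

  _∪_ : Theory → List (Formula L) → Theory
  (X ∪ A) x = X x ⊎ x ∈ A

  _∪₁_ : Theory → Formula L → Theory
  (X ∪₁ φ) x = X x ⊎ x ≡ φ

  _─_ : List (Formula L) → Formula L → List (Formula L)
  xs ─ y = filter (λ x → ¬? (lem {P = x ≡ y})) xs

  ∈-─⁻ : ∀ y xs {x} → x ∈ xs ─ y → x ∈ xs × x ≢ y
  ∈-─⁻ y xs = ∈-filter⁻ (λ x → ¬? (lem {P = x ≡ y}))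

  ∈-─⁺ : ∀ y xs {x} → x ∈ xs → x ≢ y → x ∈ xs ─ y
  ∈-─⁺ y xs = ∈-filter⁺ (λ x → ¬? (lem {P = x ≡ y}))

  symsL : List (Formula L) → List Sym
  symsL []       = []
  symsL (x ∷ xs) = symsF L x ++ symsL xs

  symsL-∈ : ∀ {x} xs {s} → x ∈ xs → s ∈ symsF L x → s ∈ symsL xs
  symsL-∈ (x ∷ xs) (here refl) s∈x = ∈-++⁺ˡ s∈x
  symsL-∈ (y ∷ xs) (there x∈xs) s∈x = ∈-++⁺ʳ (symsF L y) (symsL-∈ xs x∈xs s∈x)

  FreshLiterals : Theory → Set
  FreshLiterals X = ∀ (avoid : List Sym) → Σ[ w ∈ Lit L ] proj₁ w ∉ avoid × (∀ φ → X φ → ¬ OccursIn L w φ)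

  v₀ : Lit L
  v₀ = lit 0 , lit-ar 0

  ⊤-atom : Formula L
  ⊤-atom = eqF L (var v₀) (var v₀)

  module Calculus {ℓ} (P : List (Formula L) → Formula L → Set ℓ) where

    _⊢_ : Theory → Formula L → Set ℓ
    X ⊢ φ = Σ[ Γ ∈ List (Formula L) ] P Γ φ × (∀ x → x ∈ Γ → X x)

    IsInconsistent : Theory → Set ℓ
    IsInconsistent X = Σ[ ψ ∈ Formula L ] X ⊢ ψ × X ⊢ neg L ψ

    IsConsistent : Theory → Set ℓ
    IsConsistent X = ¬ IsInconsistent X

    ⊢-mono : ∀ {X Y} → (∀ x → X x → Y x) → ∀ {φ} → X ⊢ φ → Y ⊢ φ
    ⊢-mono X⊆Y (Γ , d , Γ⊆X) = Γ , d , λ x x∈Γ → X⊆Y x (Γ⊆X x x∈Γ)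

    inconsistent-mono : ∀ {X Y} → (∀ x → X x → Y x) → IsInconsistent X → IsInconsistent Y
    inconsistent-mono X⊆Y (ψ , ⊢ψ , ⊢¬ψ) = ψ , ⊢-mono X⊆Y ⊢ψ , ⊢-mono X⊆Y ⊢¬ψ

    Cut : Set (Level.suc Level.zero Level.⊔ ℓ)
    Cut = ∀ X φ → IsInconsistent (X ∪₁ φ) → X ⊢ neg L φ

    -- R∃←, except that the new hypotheses need only lie within {∃v₁ψ} ∪ Γ′.
    ∃-Elimination : Set ℓ
    ∃-Elimination = ∀ Γ₀ Γ′ ψ v₁ v₂ v → P Γ₀ (neg L (eqF L (var v) (var v))) →
                    SameSet L Γ₀ (renF L v₁ v₂ ψ ∷ Γ′) → ¬ OccursIn L v₂ ψ →
                    (∀ x → x ∈ Γ′ → ¬ OccursIn L v₂ x) →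
                    Σ[ Γ ∈ List (Formula L) ] (∀ x → x ∈ Γ → x ≡ ex v₁ ψ ⊎ x ∈ Γ′) ×
                                              P Γ (neg L (eqF L (var v) (var v)))

    record IsHenkinCalculus : Set (Level.suc Level.zero Level.⊔ ℓ) where
      field
        assumption : ∀ φ → P [ φ ] φ
        ≡-refl     : ∀ t → P [] (eqF L t t)
        ≡-sym      : ∀ a b → P [ eqF L a b ] (eqF L b a)
        ≡-trans    : ∀ a b c → P (eqF L a b ∷ eqF L b c ∷ []) (eqF L a c)
        ≡-cong     : ∀ s {n} (p : ar s ≡ + suc n) (ts ts′ : Vec (Term L) (suc n)) →
                     P (vtoList (zipWith (eqF L) ts ts′)) (eqF L (app s p ts) (app s p ts′))
        ≡-subst    : ∀ r {n} (p : ar r ≡ -[1+ n ]) (ts ts′ : Vec (Term L) (suc n)) →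
                     P (atom r p ts ∷ vtoList (zipWith (eqF L) ts ts′)) (atom r p ts′)
        nor-rule   : ∀ a b c d → P (nor a b ∷ nor c d ∷ []) (nor b c)
        ∃-intro    : ∀ ψ v t → P [ substF L v t ψ ] (ex v ψ)
        cut        : Cut
        ∃-elim     : ∃-Elimination

    record MaximalTheory : Set (Level.suc Level.zero Level.⊔ ℓ) where
      field
        M          : Theory
        closed     : ∀ {φ} → M ⊢ φ → M φ
        consistent : ∀ φ → M φ → M (neg L φ) → ⊥
        complete   : ∀ φ → ¬ M φ → M (neg L φ)
        henkin     : ∀ v ψ → M (ex v ψ) → Σ[ w ∈ Lit L ] ¬ OccursIn L w ψ × M (renF L v w ψ)

    module Lindenbaum (C : IsHenkinCalculus) (X : Theory) (X-consistent : IsConsistent X)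
                      (supply : FreshLiterals X) where
      open IsHenkinCalculus C

      witness : Lit L → Formula L → List (Formula L) → Lit L
      witness v ψ A = proj₁ (supply (symsL (ex v ψ ∷ A)))

      witness-∉ : ∀ v ψ A → proj₁ (witness v ψ A) ∉ symsL (ex v ψ ∷ A)
      witness-∉ v ψ A = proj₁ (proj₂ (supply (symsL (ex v ψ ∷ A))))

      add : Formula L → List (Formula L) → List (Formula L)
      add (ex v ψ) A = renF L v (witness v ψ A) ψ ∷ ex v ψ ∷ A
      add φ        A = φ ∷ A

      add-⊇ : ∀ φ A {x} → x ∈ A → x ∈ add φ A
      add-⊇ (atom _ _ _) A x∈A = there x∈A
      add-⊇ (nor _ _)    A x∈A = there x∈A
      add-⊇ (ex _ _)     A x∈A = there (there x∈A)

      add-∋ : ∀ φ A → φ ∈ add φ A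
      add-∋ (atom _ _ _) A = here refl
      add-∋ (nor _ _)    A = here refl
      add-∋ (ex _ _)     A = there (here refl)

      -- The Henkin witness is harmless: a refutation using it is turned, by cut and ∃-elimination,
      -- into a refutation of the existential formula itself.
      add-witness-consistent : ∀ v ψ A → IsConsistent (X ∪ (ex v ψ ∷ A)) → IsConsistent (X ∪ add (ex v ψ) A)
      add-witness-consistent v ψ A Y-consistent Z-inconsistent =
        Y-consistent (⊤-atom , ([] , ≡-refl _ , λ _ ()) , Y⊢¬⊤)
        where
        w : Lit L
        w = witness v ψ A
        ψ′ : Formula L
        ψ′ = renF L v w ψ
        Y Z : Theory
        Y = X ∪ (ex v ψ ∷ A)
        Z = X ∪ add (ex v ψ) A
        Z⊆Y : ∀ x → Z x → x ≢ ψ′ → Y x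
        Z⊆Y x (inj₁ x∈X)          _    = inj₁ x∈X
        Z⊆Y x (inj₂ (here x≡ψ′))  x≢ψ′ = contradiction x≡ψ′ x≢ψ′
        Z⊆Y x (inj₂ (there x∈A))  _    = inj₂ x∈A
        w∉Y : ∀ x → Y x → ¬ OccursIn L w x
        w∉Y x (inj₁ x∈X) = proj₂ (proj₂ (supply _)) x x∈X
        w∉Y x (inj₂ x∈A) w∈x = witness-∉ v ψ A (symsL-∈ (ex v ψ ∷ A) x∈A w∈x)
        Z⊢¬⊤ : Z ⊢ neg L ⊤-atom
        Z⊢¬⊤ = cut Z ⊤-atom (inconsistent-mono (λ _ → inj₁) Z-inconsistent)
        Γ₀ : List (Formula L)
        Γ₀ = proj₁ Z⊢¬⊤
        Γ₀⊆Z : ∀ x → x ∈ Γ₀ → Z x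
        Γ₀⊆Z = proj₂ (proj₂ Z⊢¬⊤)
        Y⊢¬⊤ : Y ⊢ neg L ⊤-atom
        Y⊢¬⊤ with lem {P = ψ′ ∈ Γ₀}
        ... | no ψ′∉Γ₀ = Γ₀ , proj₁ (proj₂ Z⊢¬⊤) , λ x x∈Γ₀ →
          Z⊆Y x (Γ₀⊆Z x x∈Γ₀) λ x≡ψ′ → ψ′∉Γ₀ (subst (_∈ Γ₀) x≡ψ′ x∈Γ₀)
        ... | yes ψ′∈Γ₀ =
          let Γ , Γ⊆ , d = ∃-elim Γ₀ Γ′ ψ v w v₀ (proj₁ (proj₂ Z⊢¬⊤)) same
                                  (λ w∈ψ → witness-∉ v ψ A (∈-++⁺ˡ (there w∈ψ))) (λ x x∈Γ′ → w∉Y x (Γ′⊆Y x x∈Γ′))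
          in Γ , d , λ x x∈Γ → back x (Γ⊆ x x∈Γ)
          where
          Γ′ : List (Formula L)
          Γ′ = Γ₀ ─ ψ′
          Γ′⊆Y : ∀ x → x ∈ Γ′ → Y x
          Γ′⊆Y x x∈Γ′ = let x∈Γ₀ , x≢ψ′ = ∈-─⁻ ψ′ Γ₀ x∈Γ′ in Z⊆Y x (Γ₀⊆Z x x∈Γ₀) x≢ψ′
          same : SameSet L Γ₀ (ψ′ ∷ Γ′)
          same = (λ x x∈Γ₀ → case lem {P = x ≡ ψ′} of λ where
                                (yes x≡ψ′) → here x≡ψ′
                                (no x≢ψ′)  → there (∈-─⁺ ψ′ Γ₀ x∈Γ₀ x≢ψ′))
               , λ where
                   _ (here refl)   → ψ′∈Γ₀
                   x (there x∈Γ′) → proj₁ (∈-─⁻ ψ′ Γ₀ x∈Γ′)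
          back : ∀ x → x ≡ ex v ψ ⊎ x ∈ Γ′ → Y x
          back x (inj₁ refl)   = inj₂ (here refl)
          back x (inj₂ x∈Γ′) = Γ′⊆Y x x∈Γ′

      add-consistent : ∀ φ A → IsConsistent (X ∪ (φ ∷ A)) → IsConsistent (X ∪ add φ A)
      add-consistent (atom _ _ _) A = λ c → c
      add-consistent (nor _ _)    A = λ c → c
      add-consistent (ex v ψ)     A = add-witness-consistent v ψ A

      consider : (φ : Formula L) (A : List (Formula L)) → Dec (IsConsistent (X ∪ (φ ∷ A))) → List (Formula L)
      consider φ A (yes _) = add φ A
      consider φ A (no _)  = A

      step : (n : ℕ) → List (Formula L) → Dec (Σ[ φ ∈ Formula L ] codeF φ ≡ n) → List (Formula L)
      step n A (yes (φ , _)) = consider φ A lem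
      step n A (no _)        = A

      stage : ℕ → List (Formula L)
      stage zero    = []
      stage (suc n) = step n (stage n) lem

      step-⊇ : ∀ n A d {x} → x ∈ A → x ∈ step n A d
      step-⊇ n A (no _) x∈A = x∈A
      step-⊇ n A (yes (φ , _)) x∈A with lem {P = IsConsistent (X ∪ (φ ∷ A))}
      ... | yes _ = add-⊇ φ A x∈A
      ... | no _  = x∈A

      stage-mono : ∀ {m n x} → m ≤ n → x ∈ stage m → x ∈ stage n
      stage-mono {n = zero} z≤n x∈ = x∈
      stage-mono {m} {suc n} m≤n x∈ with m≤n⇒m<n∨m≡n m≤n
      ... | inj₂ refl      = x∈
      ... | inj₁ (s≤s m≤n′) = step-⊇ n (stage n) lem (stage-mono m≤n′ x∈)

      step-consistent : ∀ n A d → IsConsistent (X ∪ A) → IsConsistent (X ∪ step n A d)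
      step-consistent n A (no _) c = c
      step-consistent n A (yes (φ , _)) c with lem {P = IsConsistent (X ∪ (φ ∷ A))}
      ... | yes c′ = add-consistent φ A c′
      ... | no _   = c

      stage-consistent : ∀ n → IsConsistent (X ∪ stage n)
      stage-consistent zero = X-consistent ∘ inconsistent-mono λ where _ (inj₁ x∈X) → x∈X
      stage-consistent (suc n) = step-consistent n (stage n) lem (stage-consistent n)

      M : Theory
      M x = X x ⊎ ∃[ n ] x ∈ stage n

      finite-⊆-stage : ∀ Γ → (∀ x → x ∈ Γ → M x) → ∃[ n ] (∀ x → x ∈ Γ → (X ∪ stage n) x)
      finite-⊆-stage [] _ = 0 , λ _ ()
      finite-⊆-stage (y ∷ Γ) Γ⊆M with finite-⊆-stage Γ (λ x x∈Γ → Γ⊆M x (there x∈Γ)) | Γ⊆M y (here refl)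
      ... | n , Γ⊆n | inj₁ y∈X = n , λ where
            _ (here refl)  → inj₁ y∈X
            x (there x∈Γ) → Γ⊆n x x∈Γ
      ... | n , Γ⊆n | inj₂ (k , y∈k) = n ⊔ k , λ where
            _ (here refl)  → inj₂ (stage-mono (m≤n⊔m n k) y∈k)
            x (there x∈Γ) → map₂ (stage-mono (m≤m⊔n n k)) (Γ⊆n x x∈Γ)

      M-consistent : IsConsistent M
      M-consistent (ψ , (Γ₁ , d₁ , Γ₁⊆M) , (Γ₂ , d₂ , Γ₂⊆M)) =
        let n , Γ⊆n = finite-⊆-stage (Γ₁ ++ Γ₂) (λ x x∈ → [ Γ₁⊆M x , Γ₂⊆M x ]′ (∈-++⁻ Γ₁ x∈))
        in stage-consistent n (ψ , (Γ₁ , d₁ , λ x x∈ → Γ⊆n x (∈-++⁺ˡ x∈))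
                                 , (Γ₂ , d₂ , λ x x∈ → Γ⊆n x (∈-++⁺ʳ Γ₁ x∈)))

      step-decides : ∀ n A d φ → codeF φ ≡ n → φ ∈ step n A d ⊎ IsInconsistent (X ∪ (φ ∷ A))
      step-decides n A (no none) φ e = contradiction (φ , e) none
      step-decides n A (yes (φ′ , e′)) φ e with codeF-injective φ′ φ (trans e′ (sym e))
      ... | refl with lem {P = IsConsistent (X ∪ (φ ∷ A))}
      ... | yes _ = inj₁ (add-∋ φ A)
      ... | no ¬c = inj₂ (em⇒dne lem ¬c)

      ∉M⇒inconsistent : ∀ φ → ¬ M φ → IsInconsistent (M ∪₁ φ)
      ∉M⇒inconsistent φ φ∉M with step-decides (codeF φ) (stage (codeF φ)) lem φ refl
      ... | inj₁ φ∈ = contradiction (inj₂ (suc (codeF φ) , φ∈)) φ∉M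
      ... | inj₂ incons = inconsistent-mono (λ where
              x (inj₁ x∈X)          → inj₁ (inj₁ x∈X)
              x (inj₂ (here x≡φ))   → inj₂ x≡φ
              x (inj₂ (there x∈A))  → inj₁ (inj₂ (codeF φ , x∈A))) incons

      M-closed : ∀ {φ} → M ⊢ φ → M φ
      M-closed {φ} M⊢φ = em⇒dne lem λ φ∉M → M-consistent (φ , M⊢φ , cut M φ (∉M⇒inconsistent φ φ∉M))

      step-witness : ∀ n A d v ψ → codeF (ex v ψ) ≡ n → IsConsistent (X ∪ (ex v ψ ∷ A)) →
                     Σ[ w ∈ Lit L ] ¬ OccursIn L w ψ × renF L v w ψ ∈ step n A d
      step-witness n A (no none) v ψ e _ = contradiction (ex v ψ , e) none
      step-witness n A (yes (φ′ , e′)) v ψ e c with codeF-injective φ′ (ex v ψ) (trans e′ (sym e))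
      ... | refl with lem {P = IsConsistent (X ∪ (ex v ψ ∷ A))}
      ... | yes _ = witness v ψ A , (λ w∈ψ → witness-∉ v ψ A (∈-++⁺ˡ (there w∈ψ))) , here refl
      ... | no ¬c = contradiction c ¬c

      M-henkin : ∀ v ψ → M (ex v ψ) → Σ[ w ∈ Lit L ] ¬ OccursIn L w ψ × M (renF L v w ψ)
      M-henkin v ψ ∃∈M =
        let w , w∉ψ , ψ′∈ = step-witness n (stage n) lem v ψ refl consistent
        in w , w∉ψ , inj₂ (suc n , ψ′∈)
        where
        n : ℕ
        n = codeF (ex v ψ)
        consistent : IsConsistent (X ∪ (ex v ψ ∷ stage n))
        consistent = M-consistent ∘ inconsistent-mono λ where
          x (inj₁ x∈X)         → inj₁ x∈X
          x (inj₂ (here refl)) → ∃∈M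
          x (inj₂ (there x∈))  → inj₂ (n , x∈)

      maximal : MaximalTheory
      maximal = record
        { M          = M
        ; closed     = M-closed
        ; consistent = λ φ φ∈M ¬φ∈M → M-consistent (φ , ([ φ ] , assumption φ , λ { _ (here refl) → φ∈M })
                                                       , ([ neg L φ ] , assumption _ , λ { _ (here refl) → ¬φ∈M }))
        ; complete   = λ φ φ∉M → M-closed (cut M φ (∉M⇒inconsistent φ φ∉M))
        ; henkin     = M-henkin
        }

    module TermModel (C : IsHenkinCalculus) (T : MaximalTheory) where
      open IsHenkinCalculus C
      open MaximalTheory T

      _~_ : Term L → Term L → Set
      a ~ b = M (eqF L a b)

      ~-refl : ∀ a → a ~ a
      ~-refl a = closed ([] , ≡-refl a , λ _ ())

      ~-sym : ∀ {a b} → a ~ b → b ~ a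
      ~-sym {a} {b} a~b = closed (_ , ≡-sym a b , λ { _ (here refl) → a~b })

      ~-trans : ∀ {a b c} → a ~ b → b ~ c → a ~ c
      ~-trans {a} {b} {c} a~b b~c =
        closed (_ , ≡-trans a b c , λ { _ (here refl) → a~b ; _ (there (here refl)) → b~c })

      CodeInClass : Term L → ℕ → Set
      CodeInClass t n = Σ[ t′ ∈ Term L ] codeT t′ ≡ n × t′ ~ t

      least-code : ∀ t → Σ[ m ∈ ℕ ] CodeInClass t m × (∀ j → CodeInClass t j → m ≤ j)
      least-code t = least (CodeInClass t) (t , refl , ~-refl t)

      min-code : Term L → ℕ
      min-code t = proj₁ (least-code t)

      min-code-∈ : ∀ t → CodeInClass t (min-code t)
      min-code-∈ t = proj₁ (proj₂ (least-code t))

      min-code-≤ : ∀ t {j} → CodeInClass t j → min-code t ≤ j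
      min-code-≤ t = proj₂ (proj₂ (least-code t)) _

      CodeInClass-cong : ∀ {t t′ n} → t ~ t′ → CodeInClass t n → CodeInClass t′ n
      CodeInClass-cong t~t′ (u , e , u~t) = u , e , ~-trans u~t t~t′

      rep : Term L → Term L
      rep t = proj₁ (min-code-∈ t)

      rep~ : ∀ t → rep t ~ t
      rep~ t = proj₂ (proj₂ (min-code-∈ t))

      rep-cong : ∀ {t t′} → t ~ t′ → rep t ≡ rep t′
      rep-cong {t} {t′} t~t′ = codeT-injective _ _ (begin
        codeT (rep t)  ≡⟨ proj₁ (proj₂ (min-code-∈ t)) ⟩
        min-code t     ≡⟨ ≤-antisym (min-code-≤ t (CodeInClass-cong (~-sym t~t′) (min-code-∈ t′)))
                                    (min-code-≤ t′ (CodeInClass-cong t~t′ (min-code-∈ t))) ⟩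
        min-code t′    ≡⟨ sym (proj₁ (proj₂ (min-code-∈ t′))) ⟩
        codeT (rep t′) ∎)
        where open ≡-Reasoning

      Carrier : Set
      Carrier = Σ[ t ∈ Term L ] rep t ≡ t

      Carrier-≡ : ∀ {a b : Carrier} → proj₁ a ≡ proj₁ b → a ≡ b
      Carrier-≡ {t , p} {.t , q} refl = cong (t ,_) (uip p q)

      class : Term L → Carrier
      class t = rep t , rep-cong (rep~ t)

      class-cong : ∀ {a b} → a ~ b → class a ≡ class b
      class-cong a~b = Carrier-≡ (rep-cong a~b)

      class-injective : ∀ {a b} → class a ≡ class b → a ~ b
      class-injective {a} {b} e = ~-trans (~-sym (rep~ a)) (subst (_~ b) (sym (cong proj₁ e)) (rep~ b))

      class-proj₁ : ∀ u → class (proj₁ u) ≡ u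
      class-proj₁ (t , e) = Carrier-≡ e

      denote : (s : Sym) (z : ℤ) → ar s ≡ z → Den L Carrier z
      denote s (+ zero)  e _  = class (var (s , e))
      denote s (+ suc n) e xs = class (app s e (vmap proj₁ xs))
      denote s -[1+ n ]  e xs = does (lem {P = M (atom s e (vmap proj₁ xs))})

      term-model : Interp L
      term-model = record { U = Carrier ; u₀ = class (var v₀) ; fun = λ s → denote s (ar s) refl }

      term-model-countable : Countable Carrier
      term-model-countable = (λ u → codeT (proj₁ u)) , λ e → Carrier-≡ (codeT-injective _ _ e)

      subst-denote : ∀ s {z} (p : ar s ≡ z) → subst (Den L Carrier) p (denote s (ar s) refl) ≡ denote s z p
      subst-denote s refl = refl

      zip-rep~ : ∀ {n} (ts : Vec (Term L) n) x → x ∈ vtoList (zipWith (eqF L) (vmap rep ts) ts) → M x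
      zip-rep~ (t ∷ ts) _ (here refl) = rep~ t
      zip-rep~ (t ∷ ts) x (there x∈) = zip-rep~ ts x x∈

      zip-~rep : ∀ {n} (ts : Vec (Term L) n) x → x ∈ vtoList (zipWith (eqF L) ts (vmap rep ts)) → M x
      zip-~rep (t ∷ ts) _ (here refl) = ~-sym (rep~ t)
      zip-~rep (t ∷ ts) x (there x∈) = zip-~rep ts x x∈

      mutual
        evalT-term-model : ∀ t → evalT L term-model t ≡ class t
        evalT-term-model (var (s , e)) = cong (λ F → F []) (subst-denote s e)
        evalT-term-model (app s p ts) =
          trans (cong (λ F → F (evalTs L term-model ts)) (subst-denote s p))
            (trans (cong (λ xs → class (app s p xs)) (evalTs-rep ts))
              (class-cong (closed (_ , ≡-cong s p (vmap rep ts) ts , zip-rep~ ts))))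

        evalTs-rep : ∀ {n} (ts : Vec (Term L) n) → vmap proj₁ (evalTs L term-model ts) ≡ vmap rep ts
        evalTs-rep []       = refl
        evalTs-rep (t ∷ ts) = cong₂ _∷_ (cong proj₁ (evalT-term-model t)) (evalTs-rep ts)

      -- By the NOR rule, ↓ab ⊢ ↓ba and then ↓ba, ↓ab ⊢ ↓aa = ¬a; symmetrically ¬b.
      M-nor : ∀ a b → M (nor a b) ⇔ (¬ M a × ¬ M b)
      M-nor a b = mk⇔ split join
        where
        from-pair : ∀ {x y} → M x → M y → ∀ w → w ∈ x ∷ y ∷ [] → M w
        from-pair x∈M y∈M _ (here refl)         = x∈M
        from-pair x∈M y∈M _ (there (here refl)) = y∈M
        split : M (nor a b) → ¬ M a × ¬ M b
        split ab = (λ a∈M → consistent a a∈M aa) , (λ b∈M → consistent b b∈M bb)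
          where
          ba : M (nor b a)
          ba = closed (_ , nor-rule a b a b , from-pair ab ab)
          aa : M (nor a a)
          aa = closed (_ , nor-rule b a a b , from-pair ba ab)
          bb : M (nor b b)
          bb = closed (_ , nor-rule a b b a , from-pair ab ba)
        join : ¬ M a × ¬ M b → M (nor a b)
        join (a∉M , b∉M) = closed (_ , nor-rule a a b b , from-pair (complete a a∉M) (complete b b∉M))

      Sat-eqF⇔M : ∀ a b → Sat L term-model (eqF L a b) ⇔ M (eqF L a b)
      Sat-eqF⇔M a b = ⇔-trans (Sat-eqF term-model a b) (mk⇔
        (λ a≡b → class-injective (trans (sym (evalT-term-model a)) (trans a≡b (evalT-term-model b))))
        (λ a~b → trans (evalT-term-model a) (trans (class-cong a~b) (sym (evalT-term-model b)))))

      Sat-relation⇔M : ∀ r {n} (p : ar r ≡ -[1+ n ]) ts → r ≢ eqs →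
                       Sat L term-model (atom r p ts) ⇔ M (atom r p ts)
      Sat-relation⇔M r p ts r≢eqs rewrite Sat-atom-≢eqs term-model p ts r≢eqs =
        mk⇔ (λ holds → holds⇒M (trans (sym value) holds)) (λ r-holds → trans value (M⇒holds r-holds))
        where
        value : subst (Den L Carrier) p (fun term-model r) (evalTs L term-model ts) ≡
                does (lem {P = M (atom r p (vmap rep ts))})
        value = trans (cong (λ F → F (evalTs L term-model ts)) (subst-denote r p))
                      (cong (λ xs → does (lem {P = M (atom r p xs)})) (evalTs-rep ts))
        holds⇒M : does (lem {P = M (atom r p (vmap rep ts))}) ≡ true → M (atom r p ts)
        holds⇒M holds = closed (_ , ≡-subst r p (vmap rep ts) ts , λ where
          _ (here refl) → does-true⇒ lem holds
          x (there x∈)  → zip-rep~ ts x x∈)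
        M⇒holds : M (atom r p ts) → does (lem {P = M (atom r p (vmap rep ts))}) ≡ true
        M⇒holds r-holds = dec-true lem (closed (_ , ≡-subst r p ts (vmap rep ts) , λ where
          _ (here refl) → r-holds
          x (there x∈)  → zip-~rep ts x x∈))

      truth : ∀ f φ → size L φ ≤ f → Sat L term-model φ ⇔ M φ
      truth f (atom r p ts) _ = case r ≟S eqs of λ where
        (yes r≡eqs) → let a , b , e = atom-eqs p ts r≡eqs
                      in subst (λ φ → Sat L term-model φ ⇔ M φ) (sym e) (Sat-eqF⇔M a b)
        (no r≢eqs)  → Sat-relation⇔M r p ts r≢eqs
      truth (suc f) (nor a b) (s≤s le) =
        ⇔-trans (¬×¬-cong-⇔ (truth f a (≤-trans (m≤m+n _ _) le)) (truth f b (≤-trans (m≤n+m _ _) le)))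
                (⇔-sym (M-nor a b))
      truth (suc f) (ex v ψ) (s≤s le) = mk⇔ Sat⇒M M⇒Sat
        where
        Sat⇒M : Sat L term-model (ex v ψ) → M (ex v ψ)
        Sat⇒M (u , sat) = closed ([ substF L v t ψ ] , ∃-intro ψ v t , λ { _ (here refl) → instance∈M })
          where
          t : Term L
          t = proj₁ u
          t-denotes-u : evalT L term-model t ≡ u
          t-denotes-u = trans (evalT-term-model t) (class-proj₁ u)
          instance∈M : M (substF L v t ψ)
          instance∈M = to (truth f (substF L v t ψ) (≤-trans (≤-reflexive (size-substF v t ψ)) le))
                          (from (Sat-substF ψ term-model v t)
                                (subst (λ x → Sat L (assign L term-model v x) ψ) (sym t-denotes-u) sat))
        M⇒Sat : M (ex v ψ) → Sat L term-model (ex v ψ)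
        M⇒Sat ∃∈M = let w , w∉ψ , ψ′∈M = henkin v ψ ∃∈M in
          litVal term-model w ,
          to (Sat-renF ψ term-model v w w∉ψ)
             (from (truth f (renF L v w ψ) (≤-trans (≤-reflexive (size-renF v w ψ)) le)) ψ′∈M)

    completeness : ∀ {X} → IsHenkinCalculus → IsConsistent X → FreshLiterals X →
                   Σ[ i ∈ Interp L ] Countable (U i) × Satisfies L i X
    completeness {X} C X-consistent supply =
      term-model , term-model-countable , λ φ φ∈X → from (truth (size L φ) φ ≤-refl) (inj₁ φ∈X)
      where
      open Lindenbaum C X X-consistent supply using (maximal)
      open TermModel C maximal

-- Two Henkin calculi: derivability in a ruleset D, and semantic consequence

module RulesetCalculus (lem : ∀ {ℓ} → ExcludedMiddle ℓ) (L : Language) (countable : Countable (Language.Sym L))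
                       (D : Ruleset L) (∃←∈D : RuleIn L (R∃← L) D) (cut-like : CutLike L D)
                       (emulates : Emulates L D (baseRules L)) where
  open Henkin lem L countable

  Derives : List (Formula L) → Formula L → Set
  Derives Γ φ = ∃[ n ] iter L D n Γ φ

  open Calculus Derives

  ⊢⇒Prov : ∀ {X φ} → X ⊢ φ → Prov L D X φ
  ⊢⇒Prov (Γ , (n , d) , Γ⊆X) = n , Γ , d , Γ⊆X

  Prov⇒⊢ : ∀ {X φ} → Prov L D X φ → X ⊢ φ
  Prov⇒⊢ (n , Γ , d , Γ⊆X) = Γ , (n , d) , Γ⊆X

  base-rule : ∀ {Γ φ} → iter L (baseRules L) 1 Γ φ → Derives Γ φ
  base-rule d = let m , d′ = emulates 0 _ _ d in suc m , d′

  SameSet-refl : ∀ Γ → SameSet L Γ Γ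
  SameSet-refl Γ = (λ _ x∈ → x∈) , (λ _ x∈ → x∈)

  ruleset-∃-elim : ∃-Elimination
  ruleset-∃-elim Γ₀ Γ′ ψ v₁ v₂ v (n , d) same v₂∉ψ v₂∉Γ′ =
    Γ , Γ⊆ , suc n , proj₁ ∃←∈D ,
    subst (λ R → R (iter L D n) Γ (neg L (eqF L (var v) (var v)))) (sym (proj₂ ∃←∈D))
          (Γ′ , ψ , v₁ , v₂ , v , (Γ₀ , d , same) , v₂∉ψ , v₂∉Γ′ , Γ⇒ , ⇒Γ , refl)
    where
    ψ′ : Formula L
    ψ′ = renF L v₁ v₂ ψ
    Γ : List (Formula L)
    Γ = ex v₁ ψ ∷ Γ′ ─ ψ′
    Γ⇒ : ∀ x → x ∈ Γ → x ≡ ex v₁ ψ ⊎ (x ∈ Γ′ × x ≢ ψ′)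
    Γ⇒ x (here x≡)   = inj₁ x≡
    Γ⇒ x (there x∈) = inj₂ (∈-─⁻ ψ′ Γ′ x∈)
    ⇒Γ : ∀ x → x ≡ ex v₁ ψ ⊎ (x ∈ Γ′ × x ≢ ψ′) → x ∈ Γ
    ⇒Γ x (inj₁ x≡)          = here x≡
    ⇒Γ x (inj₂ (x∈ , x≢ψ′)) = there (∈-─⁺ ψ′ Γ′ x∈ x≢ψ′)
    Γ⊆ : ∀ x → x ∈ Γ → x ≡ ex v₁ ψ ⊎ x ∈ Γ′
    Γ⊆ x x∈ = map₂ proj₁ (Γ⇒ x x∈)

  ruleset-calculus : IsHenkinCalculus
  ruleset-calculus = record
    { assumption = λ φ → base-rule (# 0 , SameSet-refl _)
    ; ≡-refl     = λ t → base-rule (# 1 , SameSet-refl [] , t , refl)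
    ; ≡-sym      = λ a b → base-rule (# 2 , a , b , SameSet-refl _ , refl)
    ; ≡-trans    = λ a b c → base-rule (# 3 , a , b , c , SameSet-refl _ , refl)
    ; ≡-cong     = λ s {n} p ts ts′ → base-rule (# 4 , s , n , p , ts , ts′ , SameSet-refl _ , refl)
    ; ≡-subst    = λ r {n} p ts ts′ → base-rule (# 5 , r , n , p , ts , ts′ , SameSet-refl _ , refl)
    ; nor-rule   = λ a b c d → base-rule (# 7 , a , b , c , d , SameSet-refl _ , refl)
    ; ∃-intro    = λ ψ v t → base-rule (# 6 , ψ , v , t , SameSet-refl _ , refl)
    ; cut        = λ X φ (ψ , ⊢ψ , ⊢¬ψ) → Prov⇒⊢ (cut-like X φ (ψ , ⊢⇒Prov ⊢ψ , ⊢⇒Prov ⊢¬ψ))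
    ; ∃-elim     = ruleset-∃-elim
    }

  -- A finite set of formulas leaves fresh literals, so Henkin's construction applies to it directly.
  consistent⇒finitely-satisfiable : ∀ {X} → Consistent L D X → ∀ Δ → (∀ x → x ∈ Δ → X x) →
                         Σ[ i ∈ Interp L ] (∀ x → x ∈ Δ → Sat L i x)
  consistent⇒finitely-satisfiable X-consistent Δ Δ⊆X =
    let i , _ , i⊨Δ = completeness ruleset-calculus Δ-consistent supply in i , i⊨Δ
    where
    open Syntax L using (fresh-∉)
    Δ-consistent : IsConsistent (_∈ Δ)
    Δ-consistent (ψ , ⊢ψ , ⊢¬ψ) = X-consistent (ψ , ⊢⇒Prov (⊢-mono Δ⊆X ⊢ψ) , ⊢⇒Prov (⊢-mono Δ⊆X ⊢¬ψ))
    supply : FreshLiterals (_∈ Δ)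
    supply avoid = fresh L (avoid ++ symsL Δ) , (λ w∈ → fresh-∉ _ (∈-++⁺ˡ w∈))
                 , λ φ φ∈Δ w∈φ → fresh-∉ _ (∈-++⁺ʳ avoid (symsL-∈ Δ φ∈Δ w∈φ))

module SemanticCalculus (lem : ∀ {ℓ} → ExcludedMiddle ℓ) (L : Language)
                        (countable : Countable (Language.Sym L)) where
  open Language L
  open Syntax L
  open Semantics L
  open Henkin lem L countable

  _⊨_ : List (Formula L) → Formula L → Set₁
  Γ ⊨ φ = ∀ (i : Interp L) → (∀ x → x ∈ Γ → Sat L i x) → Sat L i φ

  open Calculus _⊨_

  evalTs-zip-≡ : ∀ (i : Interp L) {n} (ts ts′ : Vec (Term L) n) →
                 (∀ x → x ∈ vtoList (zipWith (eqF L) ts ts′) → Sat L i x) → evalTs L i ts ≡ evalTs L i ts′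
  evalTs-zip-≡ i []       []         _   = refl
  evalTs-zip-≡ i (t ∷ ts) (t′ ∷ ts′) i⊨ =
    cong₂ _∷_ (to (Sat-eqF i t t′) (i⊨ _ (here refl))) (evalTs-zip-≡ i ts ts′ (λ x x∈ → i⊨ x (there x∈)))

  semantic-cut : Cut
  semantic-cut X φ (ψ , (Γ₁ , Γ₁⊨ψ , Γ₁⊆) , (Γ₂ , Γ₂⊨¬ψ , Γ₂⊆)) = Γ , Γ⊨¬φ , Γ⊆X
    where
    Γ : List (Formula L)
    Γ = (Γ₁ ++ Γ₂) ─ φ
    Γ⊆X : ∀ x → x ∈ Γ → X x
    Γ⊆X x x∈Γ with x∈ , x≢φ ← ∈-─⁻ φ (Γ₁ ++ Γ₂) x∈Γ
                 with [ Γ₁⊆ x , Γ₂⊆ x ]′ (∈-++⁻ Γ₁ x∈)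
    ... | inj₁ x∈X = x∈X
    ... | inj₂ x≡φ = contradiction x≡φ x≢φ
    Γ⊨¬φ : Γ ⊨ neg L φ
    Γ⊨¬φ i i⊨Γ = ¬φ , ¬φ
      where
      ¬φ : ¬ Sat L i φ
      ¬φ φ-holds = proj₁ (Γ₂⊨¬ψ i (λ x x∈ → i⊨ x (∈-++⁺ʳ Γ₁ x∈))) (Γ₁⊨ψ i (λ x x∈ → i⊨ x (∈-++⁺ˡ x∈)))
        where
        i⊨ : ∀ x → x ∈ Γ₁ ++ Γ₂ → Sat L i x
        i⊨ x x∈ with lem {P = x ≡ φ}
        ... | yes refl = φ-holds
        ... | no x≢φ   = i⊨Γ x (∈-─⁺ φ (Γ₁ ++ Γ₂) x∈ x≢φ)

  -- A model of ∃v₁ψ and Γ′ becomes a model of ψ[v₁/v₂] and Γ′ by giving the fresh v₂ the witness value.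
  semantic-∃-elim : ∃-Elimination
  semantic-∃-elim Γ₀ Γ′ ψ v₁ v₂ v Γ₀⊨⊥ same v₂∉ψ v₂∉Γ′ = ex v₁ ψ ∷ Γ′ , Γ⊆ , Γ⊨⊥
    where
    Γ⊆ : ∀ x → x ∈ ex v₁ ψ ∷ Γ′ → x ≡ ex v₁ ψ ⊎ x ∈ Γ′
    Γ⊆ x (here x≡)   = inj₁ x≡
    Γ⊆ x (there x∈) = inj₂ x∈
    Γ⊨⊥ : (ex v₁ ψ ∷ Γ′) ⊨ neg L (eqF L (var v) (var v))
    Γ⊨⊥ i i⊨Γ = contradiction (from (Sat-eqF j _ _) refl) (proj₁ (Γ₀⊨⊥ j j⊨Γ₀))
      where
      u : U i
      u = proj₁ (i⊨Γ _ (here refl))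
      j : Interp L
      j = assign L i v₂ u
      j⊨ψ′ : Sat L j (renF L v₁ v₂ ψ)
      j⊨ψ′ = from (Sat-renF ψ j v₁ v₂ v₂∉ψ)
        (Sat-agree ψ (assign L i v₁ u) _
           (assign-agree (sym (litVal-assign-same i v₂ u v₂ refl))
              (Agree-sym (Agree-mono (λ _ → proj₁) (assign-fresh-for v₂∉ψ))))
           (proj₂ (i⊨Γ _ (here refl))))
      j⊨Γ₀ : ∀ x → x ∈ Γ₀ → Sat L j x
      j⊨Γ₀ x x∈Γ₀ with proj₁ same x x∈Γ₀
      ... | here refl    = j⊨ψ′
      ... | there x∈Γ′ =
        Sat-agree x i _ (Agree-sym (assign-fresh-for (v₂∉Γ′ x x∈Γ′))) (i⊨Γ x (there x∈Γ′))

  semantic-calculus : IsHenkinCalculus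
  semantic-calculus = record
    { assumption = λ φ i i⊨ → i⊨ φ (here refl)
    ; ≡-refl     = λ t i _ → from (Sat-eqF i t t) refl
    ; ≡-sym      = λ a b i i⊨ → from (Sat-eqF i b a) (sym (to (Sat-eqF i a b) (i⊨ _ (here refl))))
    ; ≡-trans    = λ a b c i i⊨ → from (Sat-eqF i a c)
                     (trans (to (Sat-eqF i a b) (i⊨ _ (here refl))) (to (Sat-eqF i b c) (i⊨ _ (there (here refl)))))
    ; ≡-cong     = λ s p ts ts′ i i⊨ → from (Sat-eqF i _ _)
                     (cong (subst (Den L (U i)) p (fun i s)) (evalTs-zip-≡ i ts ts′ i⊨))
    ; ≡-subst    = λ r p ts ts′ i i⊨ → Sat-atom-cong i (fun i) r p ts ts′ (DenEq-refl (ar r) _)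
                     (evalTs-zip-≡ i ts ts′ (λ x x∈ → i⊨ x (there x∈))) (i⊨ _ (here refl))
    ; nor-rule   = λ a b c d i i⊨ → proj₂ (i⊨ _ (here refl)) , proj₁ (i⊨ _ (there (here refl)))
    ; ∃-intro    = λ ψ v t i i⊨ → evalT L i t , to (Sat-substF ψ i v t) (i⊨ _ (here refl))
    ; cut        = semantic-cut
    ; ∃-elim     = semantic-∃-elim
    }

  finitely-satisfiable⇒consistent : ∀ {Y} →
    (∀ Γ → (∀ x → x ∈ Γ → Y x) → Σ[ i ∈ Interp L ] (∀ x → x ∈ Γ → Sat L i x)) → IsConsistent Y
  finitely-satisfiable⇒consistent sat (ψ , (Γ₁ , Γ₁⊨ψ , Γ₁⊆Y) , (Γ₂ , Γ₂⊨¬ψ , Γ₂⊆Y)) =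
    proj₁ (Γ₂⊨¬ψ i (λ x x∈ → i⊨ x (∈-++⁺ʳ Γ₁ x∈))) (Γ₁⊨ψ i (λ x x∈ → i⊨ x (∈-++⁺ˡ x∈)))
    where
    model : Σ[ i ∈ Interp L ] (∀ x → x ∈ Γ₁ ++ Γ₂ → Sat L i x)
    model = sat (Γ₁ ++ Γ₂) (λ x x∈ → [ Γ₁⊆Y x , Γ₂⊆Y x ]′ (∈-++⁻ Γ₁ x∈))
    i : Interp L
    i = proj₁ model
    i⊨ : ∀ x → x ∈ Γ₁ ++ Γ₂ → Sat L i x
    i⊨ = proj₂ model

module RenamingApart (lem : ∀ {ℓ} → ExcludedMiddle ℓ) (L : Language) (countable : Countable (Language.Sym L)) where
  open Language L
  open Syntax L
  open Semantics L
  open Henkin lem L countable using (Theory; FreshLiterals)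
  open Classical lem

  private
    code : Sym → ℕ
    code = proj₁ countable

  -- ρ moves every literal to one of the form lit (pair 1 _), so the literals lit (pair 0 _) stay fresh.
  ρ : Lit L → Lit L
  ρ w = lit (pair 1 (code (proj₁ w))) , lit-ar _

  ρ-injective : ∀ w w′ → proj₁ (ρ w) ≡ proj₁ (ρ w′) → proj₁ w ≡ proj₁ w′
  ρ-injective w w′ e = proj₂ countable (proj₂ (pair-injective 1 _ 1 _ (lit-inj e)))

  mutual
    ρT : Term L → Term L
    ρT (var w)      = var (ρ w)
    ρT (app s p ts) = app s p (ρTs ts)

    ρTs : ∀ {n} → Vec (Term L) n → Vec (Term L) n
    ρTs []       = []
    ρTs (t ∷ ts) = ρT t ∷ ρTs ts

  ρF : Formula L → Formula L
  ρF (atom r p ts) = atom r p (ρTs ts)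
  ρF (nor φ ψ)     = nor (ρF φ) (ρF ψ)
  ρF (ex w φ)      = ex (ρ w) (ρF φ)

  pull-fun : (i : Interp L) (s : Sym) → Dec (ar s ≡ + 0) → Den L (U i) (ar s)
  pull-fun i s (yes e) = subst (Den L (U i)) (sym e) (λ _ → litVal i (ρ (s , e)))
  pull-fun i s (no _)  = fun i s

  pull : Interp L → Interp L
  pull i = i ⟨ (λ s → pull-fun i s (ar s ℤ≟ + 0)) ⟩

  pull-lit : ∀ (i : Interp L) w → litVal (pull i) w ≡ litVal i (ρ w)
  pull-lit i (s , e) with ar s ℤ≟ + 0
  ... | no ar≢0 = contradiction e ar≢0
  ... | yes e′ rewrite uip e e′ = cong (λ F → F []) (subst-cancel e′ _)

  pull-other : ∀ (i : Interp L) s → ar s ≢ + 0 → fun (pull i) s ≡ fun i s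
  pull-other i s ar≢0 with ar s ℤ≟ + 0
  ... | yes e = contradiction e ar≢0
  ... | no _  = refl

  mutual
    evalT-ρT : ∀ t (i : Interp L) → evalT L i (ρT t) ≡ evalT L (pull i) t
    evalT-ρT (var w) i = sym (pull-lit i w)
    evalT-ρT (app s p ts) i =
      trans (cong (subst (Den L (U i)) p (fun i s)) (evalTs-ρTs ts i))
            (cong (λ F → subst (Den L (U i)) p F _) (sym (pull-other i s (positive-arity≢0 p))))

    evalTs-ρTs : ∀ {n} (ts : Vec (Term L) n) (i : Interp L) → evalTs L i (ρTs ts) ≡ evalTs L (pull i) ts
    evalTs-ρTs []       i = refl
    evalTs-ρTs (t ∷ ts) i = cong₂ _∷_ (evalT-ρT t i) (evalTs-ρTs ts i)

  pull-assign : ∀ {i : Interp L} {w u P} → Agree (pull (assign L i (ρ w) u)) (fun (assign L (pull i) w u)) P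
  pull-assign {i} {w} {u} = agreeing λ s _ → case ar s ℤ≟ + 0 of λ where
      (yes e) → literal-agree I J (s , e) (trans (pull-lit _ (s , e)) (ρ-assign (s , e) (s ≟S proj₁ w)))
      (no ar≢0) → DenEq-≡ (ar s) (trans (pull-other _ s ar≢0)
                    (trans (assign-other i (ρ w) u s (nonliteral≢literal ar≢0 (ρ w)))
                    (sym (trans (assign-other (pull i) w u s (nonliteral≢literal ar≢0 w)) (pull-other i s ar≢0)))))
    where
    I : Interp L
    I = pull (assign L i (ρ w) u)
    J : (s : Sym) → Den L (U i) (ar s)
    J = fun (assign L (pull i) w u)
    ρ-assign : ∀ v → Dec (proj₁ v ≡ proj₁ w) → litVal (assign L i (ρ w) u) (ρ v) ≡ litVal (I ⟨ J ⟩) v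
    ρ-assign v (yes v≡w) = trans (litVal-assign-same i (ρ w) u (ρ v) (cong (λ z → lit (pair 1 (code z))) v≡w))
                                 (sym (litVal-assign-same (pull i) w u v v≡w))
    ρ-assign v (no v≢w)  = trans (litVal-assign-other i (ρ w) u (ρ v) (λ e → v≢w (ρ-injective v w e)))
                                 (sym (trans (litVal-assign-other (pull i) w u v v≢w) (pull-lit i v)))

  Sat-ρF : ∀ φ (i : Interp L) → Sat L i (ρF φ) ⇔ Sat L (pull i) φ
  Sat-ρF (atom r p ts) i =
    Sat-atom-cong-⇔ i _ r p (ρTs ts) ts (DenEq-≡ (ar r) (sym (pull-other i r (negative-arity≢0 p))))
                    (evalTs-ρTs ts i)
  Sat-ρF (nor φ ψ) i = ¬×¬-cong-⇔ (Sat-ρF φ i) (Sat-ρF ψ i)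
  Sat-ρF (ex w φ) i = ∃-cong-⇔ λ u →
    ⇔-trans (Sat-ρF φ (assign L i (ρ w) u)) (Sat-agree-⇔ φ _ _ pull-assign)

  ρ-literal : ∀ {s} w → proj₁ (ρ w) ≡ s → ar s ≡ + 0
  ρ-literal w refl = lit-ar _

  push-fun : (i : Interp L) (s : Sym) → Dec (Σ[ w ∈ Lit L ] proj₁ (ρ w) ≡ s) → Den L (U i) (ar s)
  push-fun i s (yes (w , ρw≡s)) = subst (Den L (U i)) (sym (ρ-literal w ρw≡s)) (λ _ → litVal i w)
  push-fun i s (no _)           = fun i s

  push : Interp L → Interp L
  push i = i ⟨ (λ s → push-fun i s lem) ⟩

  push-lit : ∀ (i : Interp L) w → litVal (push i) (ρ w) ≡ litVal i w
  push-lit i w with lem {P = Σ[ w′ ∈ Lit L ] proj₁ (ρ w′) ≡ proj₁ (ρ w)}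
  ... | no none = contradiction (w , refl) none
  ... | yes (w′ , e) with Lit-≡ w′ w (ρ-injective w′ w e)
  ... | refl rewrite uip e refl = cong (λ F → F []) (subst-cancel (lit-ar _) _)

  push-other : ∀ (i : Interp L) s → ar s ≢ + 0 → fun (push i) s ≡ fun i s
  push-other i s ar≢0 with lem {P = Σ[ w ∈ Lit L ] proj₁ (ρ w) ≡ s}
  ... | yes (w , ρw≡s) = contradiction (ρ-literal w ρw≡s) ar≢0
  ... | no _           = refl

  pull-push : ∀ {i : Interp L} {P} → Agree i (fun (pull (push i))) P
  pull-push {i} = agreeing λ s _ → case ar s ℤ≟ + 0 of λ where
      (yes e)   → literal-agree i (fun (pull (push i))) (s , e)
                    (sym (trans (pull-lit (push i) (s , e)) (push-lit i (s , e))))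
      (no ar≢0) → DenEq-≡ (ar s) (sym (trans (pull-other (push i) s ar≢0) (push-other i s ar≢0)))

  Sat⇒Sat-push : ∀ φ (i : Interp L) → Sat L i φ → Sat L (push i) (ρF φ)
  Sat⇒Sat-push φ i = from (Sat-ρF φ (push i)) ∘ Sat-agree φ i _ pull-push

  image : Theory → Theory
  image X φ′ = Σ[ φ ∈ Formula L ] X φ × ρF φ ≡ φ′

  preimage : ∀ {X} Γ → (∀ x → x ∈ Γ → image X x) →
             Σ[ Δ ∈ List (Formula L) ] (∀ y → y ∈ Δ → X y) ×
                                       (∀ x → x ∈ Γ → Σ[ y ∈ Formula L ] y ∈ Δ × ρF y ≡ x)
  preimage []      _   = [] , (λ _ ()) , (λ _ ())
  preimage (x ∷ Γ) Γ⊆ with preimage Γ (λ x′ x′∈ → Γ⊆ x′ (there x′∈)) | Γ⊆ x (here refl)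
  ... | Δ , Δ⊆X , covers | y , y∈X , ρy≡x = y ∷ Δ
      , (λ where _ (here refl) → y∈X
                 z (there z∈)  → Δ⊆X z z∈)
      , (λ where _ (here refl) → y , here refl , ρy≡x
                 z (there z∈)  → let y′ , y′∈ , e = covers z z∈ in y′ , there y′∈ , e)

  image-finitely-satisfiable : ∀ {X} →
    (∀ Δ → (∀ x → x ∈ Δ → X x) → Σ[ i ∈ Interp L ] (∀ x → x ∈ Δ → Sat L i x)) →
    (∀ Γ → (∀ x → x ∈ Γ → image X x) → Σ[ i ∈ Interp L ] (∀ x → x ∈ Γ → Sat L i x))
  image-finitely-satisfiable sat Γ Γ⊆ =
    let Δ , Δ⊆X , covers = preimage Γ Γ⊆
        i , i⊨Δ = sat Δ Δ⊆X
    in push i , λ x x∈ → let y , y∈Δ , ρy≡x = covers x x∈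
                         in subst (Sat L (push i)) ρy≡x (Sat⇒Sat-push y i (i⊨Δ y y∈Δ))

  mutual
    symsT-ρT : ∀ t s → s ∈ symsT L (ρT t) → ar s ≢ + 0 ⊎ Σ[ v ∈ Lit L ] s ≡ proj₁ (ρ v)
    symsT-ρT (var w)      _ (here refl) = inj₂ (w , refl)
    symsT-ρT (app _ p ts) _ (here refl) = inj₁ (positive-arity≢0 p)
    symsT-ρT (app _ p ts) s (there s∈)  = symsTs-ρTs ts s s∈

    symsTs-ρTs : ∀ {n} (ts : Vec (Term L) n) s → s ∈ symsTs L (ρTs ts) →
                 ar s ≢ + 0 ⊎ Σ[ v ∈ Lit L ] s ≡ proj₁ (ρ v)
    symsTs-ρTs (t ∷ ts) s s∈ = [ symsT-ρT t s , symsTs-ρTs ts s ]′ (∈-++⁻ (symsT L (ρT t)) s∈)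

  symsF-ρF : ∀ φ s → s ∈ symsF L (ρF φ) → ar s ≢ + 0 ⊎ Σ[ v ∈ Lit L ] s ≡ proj₁ (ρ v)
  symsF-ρF (atom _ p ts) _ (here refl) = inj₁ (negative-arity≢0 p)
  symsF-ρF (atom _ p ts) s (there s∈)  = symsTs-ρTs ts s s∈
  symsF-ρF (nor φ ψ)     s s∈          = [ symsF-ρF φ s , symsF-ρF ψ s ]′ (∈-++⁻ (symsF L (ρF φ)) s∈)
  symsF-ρF (ex w φ)      _ (here refl) = inj₂ (w , refl)
  symsF-ρF (ex w φ)      s (there s∈)  = symsF-ρF φ s s∈

  image-fresh : ∀ X → FreshLiterals (image X)
  image-fresh X avoid = w , k-fresh , w∉image
    where
    fresh-index : ∃[ k ] lit (pair 0 k) ∉ avoid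
    fresh-index = injective-avoids (λ e → proj₂ (pair-injective 0 _ 0 _ (lit-inj e))) avoid
    k : ℕ
    k = proj₁ fresh-index
    k-fresh : lit (pair 0 k) ∉ avoid
    k-fresh = proj₂ fresh-index
    w : Lit L
    w = lit (pair 0 k) , lit-ar _
    w∉image : ∀ φ′ → image X φ′ → ¬ OccursIn L w φ′
    w∉image _ (φ , _ , refl) w∈ with symsF-ρF φ _ w∈
    ... | inj₁ ar≢0    = ar≢0 (lit-ar _)
    ... | inj₂ (v , e) with () ← proj₁ (pair-injective 0 _ 1 _ (lit-inj e))

mainTheorem2 : (lem : ∀ {ℓ : Level} → ExcludedMiddle ℓ)
    → (L : Language) → Countable (Language.Sym L)
    → (X : Formula L → Set) → (D : Ruleset L)
    → RuleIn L (R∃← L) D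
    → CutLike L D
    → Emulates L D (baseRules L)
    → Consistent L D X
    → Σ[ i ∈ Interp L ] Countable (U i) × Satisfies L i X
mainTheorem2 lem L countable X D ∃←∈D cut-like emulates X-consistent =
  let j , j-countable , j⊨ρX = completeness semantic-calculus ρX-consistent (image-fresh X)
  in pull j , j-countable , λ φ φ∈X → to (Sat-ρF φ j) (j⊨ρX (ρF φ) (φ , φ∈X , refl))
  where
  open RulesetCalculus lem L countable D ∃←∈D cut-like emulates using (consistent⇒finitely-satisfiable)
  open SemanticCalculus lem L countable
  open RenamingApart lem L countable
  open Henkin lem L countable using (module Calculus)
  open Calculus _⊨_ using (IsConsistent; completeness)

  ρX-consistent : IsConsistent (image X)
  ρX-consistent =
    finitely-satisfiable⇒consistent (image-finitely-satisfiable (consistent⇒finitely-satisfiable X-consistent))
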